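{- Let $M$ be a loopless matroid on a finite set $E$ with rank function $r$. Let $\mathbf{P}$ and $\mathbf{P}'$ be partitions of $S \subseteq E$ and $S' \subseteq E$ respectively. Then there is a partition $\mathbf{Q}$ of $S \cap S'$ such that \[ \tilde r(\mathbf{P}) + \tilde r(\mathbf{P}') \ge \tilde r(\mathbf{P}\vee\mathbf{P}') + \tilde r(\mathbf{Q}), \] $\mathbf{Q}$ is a coarsening of $\mathbf{P}\wedge\mathbf{P}'$, and $\#\mathbf{P} + \#\mathbf{P}' = \#(\mathbf{P}\vee\mathbf{P}') + \#\mathbf{Q}$.
   Context: A partition of a finite set $S$ is a set of pairwise disjoint nonempty subsets of $S$ with union $S$. For a finite multiset $\mathbf{S}=\{S_1,\ldots,S_k\}$ of nonempty subsets of $E$, $\tilde r(\mathbf{S}) := \sum_{i=1}^k (2r(S_i)-1)$ and $\#\mathbf{S} := k$ (counting multiplicities). For a multiset $\mathbf{S}$ of subsets of $E$, $\mathrm{fcc}(\mathbf{S})$ is the set of inclusion-wise minimal nonempty sets $T \subseteq \bigcup\mathbf{S}$ such that for every $S \in \mathbf{S}$, either $S \cap T = \emptyset$ or $S \subseteq T$; it is a partition of $\bigcup \mathbf{S}$. For a partition $\mathbf{P}$ of $S$ and $\mathbf{P}'$ of $S'$: $\mathbf{P}\vee\mathbf{P}' := \mathrm{fcc}(\mathbf{P}\cup\mathbf{P}')$ (a partition of $S\cup S'$), and $\mathbf{P}\wedge\mathbf{P}' := \{P\cap P' : P\in\mathbf{P}, P'\in\mathbf{P}'\}\setminus\{\emptyset\}$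 (a partition of $S \cap S'$). A partition $\mathbf{Q}$ is a coarsening of a partition $\mathbf{R}$ of the same set if every part of $\mathbf{R}$ is contained in some part of $\mathbf{Q}$. -}

module Defs where

open import Data.Nat using (ℕ; zero; suc; _≤_; _+_)
open import Data.Integer as ℤ using (ℤ; +_)
open import Data.Bool using (Bool; true; false; _∧_; _∨_; not; if_then_else_)
open import Data.Bool.Properties using () renaming (_≟_ to _≟B_)
open import Data.Vec using (_∷_; [])
open import Data.Vec.Properties using (≡-dec)
open import Data.List using (List; []; _∷_; map; _++_; foldr)
open import Data.Bool.ListAction using (any; all)
open import Data.Fin using (Fin)
open import Data.Fin.Subset using (Subset; _∈_; _⊆_; _∩_; _∪_; ⊥; ⁅_⁆; ∣_∣; Nonempty)
open import Data.Fin.Subset.Properties using (nonempty?; _⊆?_)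
open import Data.Product using (Σ; _×_; ∃)
open import Relation.Binary.PropositionalEquality using (_≡_; _≢_)
open import Relation.Nullary.Decidable using (⌊_⌋)
open import Function.Bundles using (_⇔_)

record Matroid (n : ℕ) : Set where
  field
    r          : Subset n → ℕ
    r-≤-card   : ∀ X → r X ≤ ∣ X ∣
    r-mono     : ∀ {X Y} → X ⊆ Y → r X ≤ r Y
    r-submod   : ∀ X Y → r (X ∪ Y) + r (X ∩ Y) ≤ r X + r Y

Loopless : ∀ {n} → Matroid n → Set
Loopless {n} M = ∀ (e : Fin n) → Matroid.r M ⁅ e ⁆ ≡ 1

allSubsets : ∀ n → List (Subset n)
allSubsets zero    = [] ∷ []
allSubsets (suc n) = map (true ∷_) (allSubsets n) ++ map (false ∷_) (allSubsets n)

Family : ℕ → Set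
Family n = Subset n → Bool

_∈F_ : ∀ {n} → Subset n → Family n → Set
T ∈F 𝓟 = 𝓟 T ≡ true

_=ˢ_ : ∀ {n} → Subset n → Subset n → Bool
A =ˢ B = ⌊ ≡-dec _≟B_ A B ⌋

_⊆ᵇ_ : ∀ {n} → Subset n → Subset n → Bool
A ⊆ᵇ B = ⌊ A ⊆? B ⌋

nonemptyᵇ : ∀ {n} → Subset n → Bool
nonemptyᵇ A = ⌊ nonempty? A ⌋

disjointᵇ : ∀ {n} → Subset n → Subset n → Bool
disjointᵇ A B = not (nonemptyᵇ (A ∩ B))

record IsPartition {n} (𝓟 : Family n) (S : Subset n) : Set where
  field
    nonempty : ∀ T → T ∈F 𝓟 → Nonempty T
    disjoint : ∀ T T' → T ∈F 𝓟 → T' ∈F 𝓟 → T ≢ T' → T ∩ T' ≡ ⊥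
    covers   : ∀ x → x ∈ S ⇔ (∃ λ T → T ∈F 𝓟 × x ∈ T)

⋃ : ∀ {n} → Family n → Subset n
⋃ {n} 𝓢 = foldr (λ T acc → if 𝓢 T then T ∪ acc else acc) ⊥ (allSubsets n)

compatible : ∀ {n} → Family n → Subset n → Bool
compatible {n} 𝓢 T =
  all (λ S → not (𝓢 S) ∨ disjointᵇ S T ∨ (S ⊆ᵇ T)) (allSubsets n)

candidate : ∀ {n} → Family n → Subset n → Bool
candidate 𝓢 T = nonemptyᵇ T ∧ (T ⊆ᵇ ⋃ 𝓢) ∧ compatible 𝓢 T

fcc : ∀ {n} → Family n → Family n
fcc {n} 𝓢 T =
  candidate 𝓢 T ∧
  not (any (λ T' → candidate 𝓢 T' ∧ (T' ⊆ᵇ T) ∧ not (T' =ˢ T)) (allSubsets n))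

_∨ᴾ_ : ∀ {n} → Family n → Family n → Family n
(𝓟 ∨ᴾ 𝓟') = fcc (λ T → 𝓟 T ∨ 𝓟' T)

_∧ᴾ_ : ∀ {n} → Family n → Family n → Family n
_∧ᴾ_ {n} 𝓟 𝓟' T =
  nonemptyᵇ T ∧
  any (λ A → 𝓟 A ∧ any (λ B → 𝓟' B ∧ ((A ∩ B) =ˢ T)) (allSubsets n)) (allSubsets n)

IsCoarsening : ∀ {n} → Family n → Family n → Set
IsCoarsening 𝓠 𝓡 = ∀ R → R ∈F 𝓡 → ∃ λ Q → Q ∈F 𝓠 × R ⊆ Q

#_ : ∀ {n} → Family n → ℕ
#_ {n} 𝓟 = foldr (λ T acc → if 𝓟 T then suc acc else acc) 0 (allSubsets n)

r̃ : ∀ {n} → Matroid n → Family n → ℤ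
r̃ {n} M 𝓟 =
  foldr (λ T acc → if 𝓟 T then (+ (2 Data.Nat.* Matroid.r M T) ℤ.- + 1) ℤ.+ acc else acc)
        (+ 0) (allSubsets n)

-- Induction on the parts of 𝓟'. Remove a part B of 𝓟' and let 𝓠' be the partition given by the
-- induction hypothesis. Putting B back into 𝓟 ∪ 𝓟' changes the finest common coarsening only by
-- merging B with the blocks C₁, …, Cₘ that meet it into the single block K = B ∪ C₁ ∪ … ∪ Cₘ, and we
-- take 𝓠 = 𝓠' ∪ {B ∩ C₁, …, B ∩ Cₘ}. The counts stay balanced (one more part of 𝓟' and m more parts
-- of 𝓠 against m − 1 fewer blocks), and adding the Cᵢ to B one at a time, submodularity gives
-- r K + Σᵢ r (B ∩ Cᵢ) ≤ r B + Σᵢ r Cᵢ, which is exactly the increment needed for Σ r. As the counts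
-- agree, the inequality for r̃ = Σ (2r − 1) is twice the one for Σ r.

module Submission where

open import Defs
open import Data.Nat as ℕ using (ℕ; zero; suc; _+_; _≤_; _<_)
open import Data.Nat.Properties as ℕ using (+-assoc; +-identityʳ; +-monoˡ-≤; +-monoʳ-≤; +-mono-≤; ≤-refl; suc-injective)
open import Algebra.Properties.CommutativeSemigroup ℕ.+-commutativeSemigroup using (x∙yz≈y∙xz; xy∙z≈y∙xz)
open import Data.Nat.Induction using (<-wellFounded)
open import Data.Nat.Tactic.RingSolver using (solve-∀)
open import Data.Integer as ℤ using (ℤ; _≥_) renaming (_+_ to _+ℤ_)
open import Data.Integer.Properties as ℤ using ()
open import Data.Integer.Tactic.RingSolver as ℤ using ()
open import Data.Bool using (Bool; true; false; _∧_; _∨_; not; if_then_else_)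
open import Data.Bool.Properties using (∨-identityʳ; ∧-identityʳ; ¬-not; not-¬; not-involutive) renaming (_≟_ to _≟ᵇ_)
open import Data.Bool.ListAction using (any; all)
open import Data.Vec using (_∷_; [])
open import Data.Vec.Properties using (≡-dec; ∷-injectiveˡ; ∷-injectiveʳ)
open import Data.List using (List; []; _∷_; map; _++_; foldr)
open import Data.List.Membership.Propositional using () renaming (_∈_ to _∈ₗ_)
open import Data.List.Membership.Propositional.Properties using (∈-map⁺; ∈-++⁺ˡ; ∈-++⁺ʳ)
open import Data.List.Relation.Unary.Any using (here; there)
open import Data.Fin using (Fin)
open import Data.Fin.Subset
  using (Subset; _∈_; _∉_; _⊆_; _⊂_; _∩_; _∪_; ∁; ⊥; ∣_∣; Nonempty)
open import Data.Fin.Subset.Properties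
  using (nonempty?; _⊆?_; _∈?_; ⊆-antisym; x∈p∩q⁺; x∈p∩q⁻; x∈p∪q⁺; x∈p∪q⁻; ∉⊥; Empty-unique;
         x∈∁p⇒x∉p; x∉p⇒x∈∁p; p⊂q⇒∣p∣<∣q∣;
         ∪-identityʳ; ∪-assoc; ∩-distribʳ-∪; p∩q⊆p; p∩q⊆q)
open import Data.Product using (_×_; ∃; ∃₂; _,_; proj₁; proj₂)
open import Data.Sum using (_⊎_; inj₁; inj₂; [_,_]′)
open import Data.Empty using (⊥-elim) renaming (⊥ to ∅)
open import Function using (_∘_; case_of_)
open import Function.Bundles using (_⇔_; mk⇔; Equivalence)
open import Induction.WellFounded using (module All)
open import Level using (0ℓ)
open import Relation.Binary.Construct.On as On using ()
open import Relation.Binary.PropositionalEquality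
  using (_≡_; _≢_; _≗_; refl; sym; trans; cong; cong₂; subst; module ≡-Reasoning)
open import Relation.Nullary using (Dec; yes; no)
open import Relation.Nullary.Decidable using (⌊_⌋)

false≢true : false ≢ true
false≢true ()

∨-true⁻ : ∀ {a b} → a ∨ b ≡ true → a ≡ true ⊎ b ≡ true
∨-true⁻ {true}  _ = inj₁ refl
∨-true⁻ {false} b = inj₂ b

∨-trueˡ : ∀ {a} b → a ≡ true → a ∨ b ≡ true
∨-trueˡ _ refl = refl

∨-trueʳ : ∀ a {b} → b ≡ true → a ∨ b ≡ true
∨-trueʳ true  _ = refl
∨-trueʳ false b = b

∧-true⁻ : ∀ {a b} → a ∧ b ≡ true → a ≡ true × b ≡ true
∧-true⁻ {true} {true} _ = refl , refl

∧-true⁺ : ∀ {a b} → a ≡ true → b ≡ true → a ∧ b ≡ true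
∧-true⁺ refl refl = refl

not-true⁻ : ∀ {a} → not a ≡ true → a ≢ true
not-true⁻ {true} () _

not-true⁺ : ∀ {a} → a ≢ true → not a ≡ true
not-true⁺ {true}  a≢t = ⊥-elim (a≢t refl)
not-true⁺ {false} _   = refl

≡true-ext : ∀ {a b} → (a ≡ true → b ≡ true) → (b ≡ true → a ≡ true) → a ≡ b
≡true-ext {true}  {true}  _ _ = refl
≡true-ext {true}  {false} f _ = sym (f refl)
≡true-ext {false} {true}  _ g = g refl
≡true-ext {false} {false} _ _ = refl

⌊⌋-true⁻ : ∀ {P : Set} (P? : Dec P) → ⌊ P? ⌋ ≡ true → P
⌊⌋-true⁻ (yes p) _ = p

⌊⌋-true⁺ : ∀ {P : Set} (P? : Dec P) → P → ⌊ P? ⌋ ≡ true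
⌊⌋-true⁺ (yes _) _ = refl
⌊⌋-true⁺ (no ¬p) p = ⊥-elim (¬p p)

module _ {n : ℕ} where

  Disjoint : Subset n → Subset n → Set
  Disjoint A B = ∀ x → x ∈ A → x ∈ B → ∅

  Disjoint-sym : ∀ {A B} → Disjoint A B → Disjoint B A
  Disjoint-sym d x x∈B x∈A = d x x∈A x∈B

  Disjoint⇒∩≡⊥ : ∀ {A B} → Disjoint A B → A ∩ B ≡ ⊥
  Disjoint⇒∩≡⊥ {A} {B} d = Empty-unique λ (x , x∈A∩B) → let (x∈A , x∈B) = x∈p∩q⁻ A B x∈A∩B in d x x∈A x∈B

  ∩≡⊥⇒Disjoint : ∀ {A B} → A ∩ B ≡ ⊥ → Disjoint A B
  ∩≡⊥⇒Disjoint A∩B≡⊥ x x∈A x∈B = ∉⊥ (subst (x ∈_) A∩B≡⊥ (x∈p∩q⁺ (x∈A , x∈B)))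

  PairwiseDisjoint : Family n → Set
  PairwiseDisjoint 𝓜 = ∀ {C D} → C ∈F 𝓜 → D ∈F 𝓜 → C ≢ D → Disjoint C D

  ⊆∧≢⇒⊂ : ∀ {A B : Subset n} → A ⊆ B → A ≢ B → A ⊂ B
  ⊆∧≢⇒⊂ {A} {B} A⊆B A≢B with nonempty? (B ∩ ∁ A)
  ... | yes (x , x∈) = A⊆B , x , p∩q⊆p B (∁ A) x∈ , x∈∁p⇒x∉p (p∩q⊆q B (∁ A) x∈)
  ... | no  ¬ne      = ⊥-elim (A≢B (⊆-antisym A⊆B B⊆A))
    where
    B⊆A : B ⊆ A
    B⊆A {x} x∈B with x ∈? A
    ... | yes x∈A = x∈A
    ... | no  x∉A = ⊥-elim (¬ne (x , x∈p∩q⁺ (x∈B , x∉p⇒x∈∁p x∉A)))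

  ∩∁-⊂ : ∀ {A B : Subset n} → A ⊆ B → Nonempty A → B ∩ ∁ A ⊂ B
  ∩∁-⊂ {A} {B} A⊆B (x , x∈A) = p∩q⊆p B (∁ A) , x , A⊆B x∈A , λ x∈ → x∈∁p⇒x∉p (p∩q⊆q B (∁ A) x∈) x∈A

  _≟ˢ_ : (A B : Subset n) → Dec (A ≡ B)
  _≟ˢ_ = ≡-dec _≟ᵇ_

  =ˢ⁻ : ∀ {A B : Subset n} → A =ˢ B ≡ true → A ≡ B
  =ˢ⁻ {A} {B} = ⌊⌋-true⁻ (A ≟ˢ B)

  =ˢ⁺ : ∀ {A B : Subset n} → A ≡ B → A =ˢ B ≡ true
  =ˢ⁺ {A} {B} = ⌊⌋-true⁺ (A ≟ˢ B)

  ⊆ᵇ⁻ : ∀ {A B : Subset n} → A ⊆ᵇ B ≡ true → A ⊆ B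
  ⊆ᵇ⁻ {A} {B} = ⌊⌋-true⁻ (A ⊆? B)

  ⊆ᵇ⁺ : ∀ {A B : Subset n} → A ⊆ B → A ⊆ᵇ B ≡ true
  ⊆ᵇ⁺ {A} {B} = ⌊⌋-true⁺ (A ⊆? B)

  nonemptyᵇ⁻ : ∀ {A : Subset n} → nonemptyᵇ A ≡ true → Nonempty A
  nonemptyᵇ⁻ {A} = ⌊⌋-true⁻ (nonempty? A)

  nonemptyᵇ⁺ : ∀ {A : Subset n} → Nonempty A → nonemptyᵇ A ≡ true
  nonemptyᵇ⁺ {A} = ⌊⌋-true⁺ (nonempty? A)

  disjointᵇ⁻ : ∀ {A B : Subset n} → disjointᵇ A B ≡ true → Disjoint A B
  disjointᵇ⁻ d x x∈A x∈B = not-true⁻ d (nonemptyᵇ⁺ (x , x∈p∩q⁺ (x∈A , x∈B)))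

  disjointᵇ⁺ : ∀ {A B : Subset n} → Disjoint A B → disjointᵇ A B ≡ true
  disjointᵇ⁺ {A} {B} d = not-true⁺ λ ne →
    let (x , x∈A∩B) = nonemptyᵇ⁻ ne ; (x∈A , x∈B) = x∈p∩q⁻ A B x∈A∩B in d x x∈A x∈B

  meetsᵇ⁻ : ∀ {A B : Subset n} → not (disjointᵇ A B) ≡ true → Nonempty (A ∩ B)
  meetsᵇ⁻ m = nonemptyᵇ⁻ (trans (sym (not-involutive _)) m)

  meetsᵇ⁺ : ∀ {A B : Subset n} → Nonempty (A ∩ B) → not (disjointᵇ A B) ≡ true
  meetsᵇ⁺ ne = trans (not-involutive _) (nonemptyᵇ⁺ ne)

∈-allSubsets : ∀ {n} (T : Subset n) → T ∈ₗ allSubsets n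
∈-allSubsets []                  = here refl
∈-allSubsets {suc n} (true ∷ T)  = ∈-++⁺ˡ (∈-map⁺ (true ∷_) (∈-allSubsets T))
∈-allSubsets {suc n} (false ∷ T) =
  ∈-++⁺ʳ (map (true ∷_) (allSubsets n)) (∈-map⁺ (false ∷_) (∈-allSubsets T))

module _ {A : Set} (p : A → Bool) where

  all-true⁻ : ∀ {xs} → all p xs ≡ true → ∀ {x} → x ∈ₗ xs → p x ≡ true
  all-true⁻ {y ∷ _} h (here refl) = proj₁ (∧-true⁻ h)
  all-true⁻ {y ∷ _} h (there x∈)  = all-true⁻ (proj₂ (∧-true⁻ {p y} h)) x∈

  all-true⁺ : ∀ xs → (∀ x → p x ≡ true) → all p xs ≡ true
  all-true⁺ []       _ = refl
  all-true⁺ (x ∷ xs) h = ∧-true⁺ (h x) (all-true⁺ xs h)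

  any-true⁻ : ∀ xs → any p xs ≡ true → ∃ λ x → p x ≡ true
  any-true⁻ (x ∷ xs) h with ∨-true⁻ {p x} h
  ... | inj₁ px  = x , px
  ... | inj₂ pxs = any-true⁻ xs pxs

  any-true⁺ : ∀ {xs x} → x ∈ₗ xs → p x ≡ true → any p xs ≡ true
  any-true⁺ {_ ∷ xs} (here refl) px = ∨-trueˡ (any p xs) px
  any-true⁺ {y ∷ _}  (there x∈)  px = ∨-trueʳ (p y) (any-true⁺ x∈ px)

module _ {n : ℕ} where

  ∅ᶠ : Family n
  ∅ᶠ _ = false

  ⁅_⁆ᶠ : Subset n → Family n
  ⁅ X ⁆ᶠ T = T =ˢ X

  _∪ᶠ_ : Family n → Family n → Family n
  (𝓐 ∪ᶠ 𝓑) T = 𝓐 T ∨ 𝓑 T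

  _∖ᶠ_ : Family n → Subset n → Family n
  (𝓐 ∖ᶠ X) T = 𝓐 T ∧ not (T =ˢ X)

  image : (Subset n → Subset n) → Family n → Family n
  image g 𝓜 T = any (λ C → 𝓜 C ∧ (g C =ˢ T)) (allSubsets n)

  ∈-∖ᶠ⁻ : ∀ (𝓐 : Family n) X {T} → T ∈F (𝓐 ∖ᶠ X) → T ∈F 𝓐 × T ≢ X
  ∈-∖ᶠ⁻ 𝓐 X T∈ = proj₁ (∧-true⁻ T∈) , λ T≡X → not-true⁻ (proj₂ (∧-true⁻ {𝓐 _} T∈)) (=ˢ⁺ T≡X)

  ∈-∖ᶠ⁺ : ∀ (𝓐 : Family n) X {T} → T ∈F 𝓐 → T ≢ X → T ∈F (𝓐 ∖ᶠ X)
  ∈-∖ᶠ⁺ _ _ T∈ T≢X = ∧-true⁺ T∈ (not-true⁺ (T≢X ∘ =ˢ⁻))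

  ∈-image⁻ : ∀ (g : Subset n → Subset n) 𝓜 {T} → T ∈F image g 𝓜 → ∃ λ C → C ∈F 𝓜 × g C ≡ T
  ∈-image⁻ g 𝓜 T∈ with any-true⁻ _ (allSubsets n) T∈
  ... | C , h = C , proj₁ (∧-true⁻ h) , =ˢ⁻ (proj₂ (∧-true⁻ {𝓜 C} h))

  ∈-image⁺ : ∀ (g : Subset n → Subset n) 𝓜 {C} → C ∈F 𝓜 → g C ∈F image g 𝓜
  ∈-image⁺ g 𝓜 {C} C∈ = any-true⁺ _ (∈-allSubsets C) (∧-true⁺ C∈ (=ˢ⁺ refl))

  _∈⋃_ : Fin n → Family n → Set
  x ∈⋃ 𝓢 = ∃ λ S → S ∈F 𝓢 × x ∈ S

  private
    ⋃ₗ : Family n → List (Subset n) → Subset n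
    ⋃ₗ 𝓢 = foldr (λ T acc → if 𝓢 T then T ∪ acc else acc) ⊥

    ∈-⋃ₗ⁻ : ∀ 𝓢 L {x} → x ∈ ⋃ₗ 𝓢 L → x ∈⋃ 𝓢
    ∈-⋃ₗ⁻ 𝓢 []      x∈ = ⊥-elim (∉⊥ x∈)
    ∈-⋃ₗ⁻ 𝓢 (T ∷ L) x∈ with 𝓢 T in T∈
    ... | false = ∈-⋃ₗ⁻ 𝓢 L x∈
    ... | true with x∈p∪q⁻ T _ x∈
    ...   | inj₁ x∈T = T , T∈ , x∈T
    ...   | inj₂ x∈L = ∈-⋃ₗ⁻ 𝓢 L x∈L

    ∈-⋃ₗ⁺ : ∀ 𝓢 {L S x} → S ∈ₗ L → S ∈F 𝓢 → x ∈ S → x ∈ ⋃ₗ 𝓢 L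
    ∈-⋃ₗ⁺ 𝓢 (here refl) S∈ x∈S rewrite S∈ = x∈p∪q⁺ (inj₁ x∈S)
    ∈-⋃ₗ⁺ 𝓢 {T ∷ _} (there S∈L) S∈ x∈S with 𝓢 T
    ... | true  = x∈p∪q⁺ (inj₂ (∈-⋃ₗ⁺ 𝓢 S∈L S∈ x∈S))
    ... | false = ∈-⋃ₗ⁺ 𝓢 S∈L S∈ x∈S

  ∈-⋃⁻ : ∀ {𝓢 x} → x ∈ ⋃ 𝓢 → x ∈⋃ 𝓢
  ∈-⋃⁻ {𝓢} = ∈-⋃ₗ⁻ 𝓢 (allSubsets n)

  ∈-⋃⁺ : ∀ {𝓢 x} → x ∈⋃ 𝓢 → x ∈ ⋃ 𝓢
  ∈-⋃⁺ {𝓢} (S , S∈ , x∈S) = ∈-⋃ₗ⁺ 𝓢 (∈-allSubsets S) S∈ x∈S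

-- By recursion rather than foldr, so that ∑ 𝓕 f stays a neutral term whose arguments Agda can
-- infer; # is related to it by #≡∑1.
∑ₗ : ∀ {n} → List (Subset n) → Family n → (Subset n → ℕ) → ℕ
∑ₗ []      𝓕 f = 0
∑ₗ (T ∷ L) 𝓕 f = if 𝓕 T then f T + ∑ₗ L 𝓕 f else ∑ₗ L 𝓕 f

∑ : ∀ {n} → Family n → (Subset n → ℕ) → ℕ
∑ {n} = ∑ₗ (allSubsets n)

module _ {n : ℕ} where

  ∑ₗ-++ : ∀ xs ys {𝓕 : Family n} {f} → ∑ₗ (xs ++ ys) 𝓕 f ≡ ∑ₗ xs 𝓕 f + ∑ₗ ys 𝓕 f
  ∑ₗ-++ []       ys = refl
  ∑ₗ-++ (x ∷ xs) ys {𝓕} {f} with 𝓕 x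
  ... | true  = trans (cong (f x +_) (∑ₗ-++ xs ys)) (sym (+-assoc (f x) _ _))
  ... | false = ∑ₗ-++ xs ys

  ∑ₗ-map : ∀ {m} (g : Subset m → Subset n) xs {𝓕 f} → ∑ₗ (map g xs) 𝓕 f ≡ ∑ₗ xs (𝓕 ∘ g) (f ∘ g)
  ∑ₗ-map g []       = refl
  ∑ₗ-map g (x ∷ xs) {𝓕} {f} with 𝓕 (g x)
  ... | true  = cong (f (g x) +_) (∑ₗ-map g xs)
  ... | false = ∑ₗ-map g xs

  ∑-cong : ∀ {𝓐 𝓑 : Family n} {f} → 𝓐 ≗ 𝓑 → ∑ 𝓐 f ≡ ∑ 𝓑 f
  ∑-cong {𝓐} {𝓑} {f} 𝓐≗𝓑 = go (allSubsets n)
    where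
    go : ∀ L → ∑ₗ L 𝓐 f ≡ ∑ₗ L 𝓑 f
    go []      = refl
    go (T ∷ L) rewrite 𝓐≗𝓑 T = cong (λ s → if 𝓑 T then f T + s else s) (go L)

  ∑-empty : ∀ {𝓜 : Family n} → 𝓜 ≗ ∅ᶠ → ∀ f → ∑ 𝓜 f ≡ 0
  ∑-empty {𝓜} 𝓜≗∅ f = go (allSubsets n)
    where
    go : ∀ L → ∑ₗ L 𝓜 f ≡ 0
    go []                        = refl
    go (T ∷ L) rewrite 𝓜≗∅ T = go L

∑-suc : ∀ {n} {𝓕 : Family (suc n)} {f} →
  ∑ 𝓕 f ≡ ∑ (𝓕 ∘ (true ∷_)) (f ∘ (true ∷_)) + ∑ (𝓕 ∘ (false ∷_)) (f ∘ (false ∷_))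
∑-suc {n} = trans (∑ₗ-++ (map (true ∷_) (allSubsets n)) _)
                  (cong₂ _+_ (∑ₗ-map (true ∷_) (allSubsets n)) (∑ₗ-map (false ∷_) (allSubsets n)))

⁅⁆ᶠ-∷ : ∀ {n} b (X : Subset n) → (⁅ b ∷ X ⁆ᶠ ∘ (b ∷_)) ≗ ⁅ X ⁆ᶠ
⁅⁆ᶠ-∷ b X T = ≡true-ext (=ˢ⁺ ∘ ∷-injectiveʳ ∘ =ˢ⁻) (=ˢ⁺ ∘ cong (b ∷_) ∘ =ˢ⁻)

⁅⁆ᶠ-∷-not : ∀ {n} b (X : Subset n) → (⁅ b ∷ X ⁆ᶠ ∘ (not b ∷_)) ≗ ∅ᶠ
⁅⁆ᶠ-∷-not b X T = ¬-not λ e → not-¬ refl (sym (∷-injectiveˡ (=ˢ⁻ e)))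

∑-⁅⁆ᶠ : ∀ {n} (X : Subset n) {f} → ∑ ⁅ X ⁆ᶠ f ≡ f X
∑-⁅⁆ᶠ []              = +-identityʳ _
∑-⁅⁆ᶠ (true ∷ X) {f}  = begin
  ∑ ⁅ true ∷ X ⁆ᶠ f
    ≡⟨ ∑-suc {𝓕 = ⁅ true ∷ X ⁆ᶠ} ⟩
  ∑ (⁅ true ∷ X ⁆ᶠ ∘ (true ∷_)) (f ∘ (true ∷_)) + ∑ (⁅ true ∷ X ⁆ᶠ ∘ (false ∷_)) (f ∘ (false ∷_))
    ≡⟨ cong₂ _+_ (trans (∑-cong (⁅⁆ᶠ-∷ true X)) (∑-⁅⁆ᶠ X)) (∑-empty (⁅⁆ᶠ-∷-not true X) _) ⟩
  f (true ∷ X) + 0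
    ≡⟨ +-identityʳ _ ⟩
  f (true ∷ X) ∎
  where open ≡-Reasoning
∑-⁅⁆ᶠ (false ∷ X) {f} = begin
  ∑ ⁅ false ∷ X ⁆ᶠ f
    ≡⟨ ∑-suc {𝓕 = ⁅ false ∷ X ⁆ᶠ} ⟩
  ∑ (⁅ false ∷ X ⁆ᶠ ∘ (true ∷_)) (f ∘ (true ∷_)) + ∑ (⁅ false ∷ X ⁆ᶠ ∘ (false ∷_)) (f ∘ (false ∷_))
    ≡⟨ cong₂ _+_ (∑-empty (⁅⁆ᶠ-∷-not false X) _) (trans (∑-cong (⁅⁆ᶠ-∷ false X)) (∑-⁅⁆ᶠ X)) ⟩
  f (false ∷ X) ∎
  where open ≡-Reasoning

module _ {n : ℕ} where

  #≡∑1 : ∀ (𝓕 : Family n) → # 𝓕 ≡ ∑ 𝓕 (λ _ → 1)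
  #≡∑1 𝓕 = go (allSubsets n)
    where
    go : ∀ L → foldr (λ T acc → if 𝓕 T then suc acc else acc) 0 L ≡ ∑ₗ L 𝓕 (λ _ → 1)
    go []      = refl
    go (T ∷ L) = cong (λ s → if 𝓕 T then suc s else s) (go L)

  ∑-∪ᶠ : ∀ (𝓐 𝓑 : Family n) {f} → (∀ T → T ∈F 𝓐 → T ∈F 𝓑 → ∅) → ∑ (𝓐 ∪ᶠ 𝓑) f ≡ ∑ 𝓐 f + ∑ 𝓑 f
  ∑-∪ᶠ 𝓐 𝓑 {f} disjoint = go (allSubsets n)
    where
    go : ∀ L → ∑ₗ L (𝓐 ∪ᶠ 𝓑) f ≡ ∑ₗ L 𝓐 f + ∑ₗ L 𝓑 f
    go []      = refl
    go (T ∷ L) with 𝓐 T in T∈𝓐 | 𝓑 T in T∈𝓑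
    ... | true  | true  = ⊥-elim (disjoint T T∈𝓐 T∈𝓑)
    ... | true  | false = trans (cong (f T +_) (go L)) (sym (+-assoc (f T) _ _))
    ... | false | true  = trans (cong (f T +_) (go L)) (x∙yz≈y∙xz (f T) (∑ₗ L 𝓐 f) (∑ₗ L 𝓑 f))
    ... | false | false = go L

  ∖ᶠ-split : ∀ (𝓕 : Family n) {X} → X ∈F 𝓕 → 𝓕 ≗ ⁅ X ⁆ᶠ ∪ᶠ (𝓕 ∖ᶠ X)
  ∖ᶠ-split 𝓕 {X} X∈ T with T =ˢ X in T≟X
  ... | true  = subst (λ Z → 𝓕 Z ≡ true) (sym (=ˢ⁻ T≟X)) X∈
  ... | false = sym (∧-identityʳ (𝓕 T))

  ∑-∖ᶠ : ∀ (𝓕 : Family n) {X f} → X ∈F 𝓕 → ∑ 𝓕 f ≡ f X + ∑ (𝓕 ∖ᶠ X) f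
  ∑-∖ᶠ 𝓕 {X} {f} X∈ = begin
    ∑ 𝓕 f                             ≡⟨ ∑-cong (∖ᶠ-split 𝓕 X∈) ⟩
    ∑ (⁅ X ⁆ᶠ ∪ᶠ (𝓕 ∖ᶠ X)) f          ≡⟨ ∑-∪ᶠ ⁅ X ⁆ᶠ (𝓕 ∖ᶠ X) (λ T T≡X T∈ → proj₂ (∈-∖ᶠ⁻ 𝓕 X T∈) (=ˢ⁻ T≡X)) ⟩
    ∑ ⁅ X ⁆ᶠ f + ∑ (𝓕 ∖ᶠ X) f         ≡⟨ cong (_+ ∑ (𝓕 ∖ᶠ X) f) (∑-⁅⁆ᶠ X) ⟩
    f X + ∑ (𝓕 ∖ᶠ X) f                ∎
    where open ≡-Reasoning

  #-∖ᶠ : ∀ (𝓕 : Family n) {X} → X ∈F 𝓕 → # 𝓕 ≡ suc (# (𝓕 ∖ᶠ X))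
  #-∖ᶠ 𝓕 {X} X∈ = trans (#≡∑1 𝓕) (trans (∑-∖ᶠ 𝓕 X∈) (cong suc (sym (#≡∑1 (𝓕 ∖ᶠ X)))))

  ∑≢0⇒member : ∀ {𝓕 f} → ∑ 𝓕 f ≢ 0 → ∃ λ X → X ∈F 𝓕
  ∑≢0⇒member {𝓕} {f} = go (allSubsets n)
    where
    go : ∀ L → ∑ₗ L 𝓕 f ≢ 0 → ∃ λ X → X ∈F 𝓕
    go []      ∑≢0 = ⊥-elim (∑≢0 refl)
    go (T ∷ L) ∑≢0 with 𝓕 T in T∈
    ... | true  = T , T∈
    ... | false = go L ∑≢0

  family-ind : (P : Family n → Set) →
    (∀ {𝓕} → 𝓕 ≗ ∅ᶠ → P 𝓕) →
    (∀ {𝓕 X} → X ∈F 𝓕 → P (𝓕 ∖ᶠ X) → P 𝓕) →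
    ∀ 𝓕 → P 𝓕
  family-ind P base step 𝓕 = go (# 𝓕) 𝓕 refl
    where
    go : ∀ k 𝓕 → # 𝓕 ≡ k → P 𝓕
    go zero    𝓕 #𝓕≡0 = base λ T → ¬-not λ T∈ → ℕ.0≢1+n (trans (sym #𝓕≡0) (#-∖ᶠ 𝓕 T∈))
    go (suc k) 𝓕 #𝓕≡1+k with ∑≢0⇒member {𝓕} {λ _ → 1} (λ ∑≡0 → ℕ.0≢1+n (sym (trans (sym #𝓕≡1+k) (trans (#≡∑1 𝓕) ∑≡0))))
    ... | X , X∈ = step X∈ (go k (𝓕 ∖ᶠ X) (suc-injective (trans (sym (#-∖ᶠ 𝓕 X∈)) #𝓕≡1+k)))

  module _ (g : Subset n → Subset n) where

    InjectiveOn : Family n → Set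
    InjectiveOn 𝓜 = ∀ {C C'} → C ∈F 𝓜 → C' ∈F 𝓜 → g C ≡ g C' → C ≡ C'

    image-∅ᶠ : ∀ {𝓜} → 𝓜 ≗ ∅ᶠ → image g 𝓜 ≗ ∅ᶠ
    image-∅ᶠ 𝓜≗∅ T = ¬-not λ T∈ → let (C , C∈ , _) = ∈-image⁻ g _ T∈ in false≢true (trans (sym (𝓜≗∅ C)) C∈)

    image-∖ᶠ-split : ∀ {𝓜 X} → X ∈F 𝓜 → image g 𝓜 ≗ ⁅ g X ⁆ᶠ ∪ᶠ image g (𝓜 ∖ᶠ X)
    image-∖ᶠ-split {𝓜} {X} X∈ T = ≡true-ext to from
      where
      to : T ∈F image g 𝓜 → T ∈F (⁅ g X ⁆ᶠ ∪ᶠ image g (𝓜 ∖ᶠ X))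
      to T∈ with ∈-image⁻ g 𝓜 T∈
      ... | C , C∈ , refl with C ≟ˢ X
      ...   | yes refl = ∨-trueˡ _ (=ˢ⁺ {A = g X} refl)
      ...   | no  C≢X  = ∨-trueʳ (g C =ˢ g X) (∈-image⁺ g (𝓜 ∖ᶠ X) (∈-∖ᶠ⁺ 𝓜 X C∈ C≢X))
      from : T ∈F (⁅ g X ⁆ᶠ ∪ᶠ image g (𝓜 ∖ᶠ X)) → T ∈F image g 𝓜
      from T∈ with ∨-true⁻ {T =ˢ g X} T∈
      ... | inj₁ T≡gX = subst (_∈F image g 𝓜) (sym (=ˢ⁻ T≡gX)) (∈-image⁺ g 𝓜 X∈)
      ... | inj₂ T∈′  = let (C , C∈ , gC≡T) = ∈-image⁻ g (𝓜 ∖ᶠ X) T∈′ in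
                          subst (_∈F image g 𝓜) gC≡T (∈-image⁺ g 𝓜 (proj₁ (∈-∖ᶠ⁻ 𝓜 X C∈)))

    ∑-image : ∀ 𝓜 {f} → InjectiveOn 𝓜 → ∑ (image g 𝓜) f ≡ ∑ 𝓜 (f ∘ g)
    ∑-image 𝓜 {f} = family-ind Reindexes base step 𝓜
      where
      Reindexes : Family n → Set
      Reindexes 𝓜 = InjectiveOn 𝓜 → ∑ (image g 𝓜) f ≡ ∑ 𝓜 (f ∘ g)
      base : ∀ {𝓜} → 𝓜 ≗ ∅ᶠ → Reindexes 𝓜
      base 𝓜≗∅ _ = trans (∑-empty (image-∅ᶠ 𝓜≗∅) f) (sym (∑-empty 𝓜≗∅ (f ∘ g)))
      step : ∀ {𝓜 X} → X ∈F 𝓜 → Reindexes (𝓜 ∖ᶠ X) → Reindexes 𝓜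
      step {𝓜} {X} X∈ ih inj = begin
        ∑ (image g 𝓜) f                              ≡⟨ ∑-cong (image-∖ᶠ-split X∈) ⟩
        ∑ (⁅ g X ⁆ᶠ ∪ᶠ image g (𝓜 ∖ᶠ X)) f          ≡⟨ ∑-∪ᶠ ⁅ g X ⁆ᶠ (image g (𝓜 ∖ᶠ X)) apart ⟩
        ∑ ⁅ g X ⁆ᶠ f + ∑ (image g (𝓜 ∖ᶠ X)) f        ≡⟨ cong₂ _+_ (∑-⁅⁆ᶠ (g X)) (ih inj′) ⟩
        f (g X) + ∑ (𝓜 ∖ᶠ X) (f ∘ g)                 ≡⟨ sym (∑-∖ᶠ 𝓜 X∈) ⟩
        ∑ 𝓜 (f ∘ g)                                   ∎
        where
        open ≡-Reasoning
        inj′ : InjectiveOn (𝓜 ∖ᶠ X)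
        inj′ C∈ C′∈ = inj (proj₁ (∈-∖ᶠ⁻ 𝓜 X C∈)) (proj₁ (∈-∖ᶠ⁻ 𝓜 X C′∈))
        apart : ∀ T → T ∈F ⁅ g X ⁆ᶠ → T ∈F image g (𝓜 ∖ᶠ X) → ∅
        apart T T≡gX T∈ with ∈-image⁻ g (𝓜 ∖ᶠ X) T∈
        ... | C , C∈ , gC≡T = let (C∈𝓜 , C≢X) = ∈-∖ᶠ⁻ 𝓜 X C∈ in C≢X (inj C∈𝓜 X∈ (trans gC≡T (=ˢ⁻ T≡gX)))

module _ {n : ℕ} where

  ⋃-∅ᶠ : ∀ {𝓜 : Family n} → 𝓜 ≗ ∅ᶠ → ⋃ 𝓜 ≡ ⊥
  ⋃-∅ᶠ 𝓜≗∅ = Empty-unique λ (x , x∈) → let (S , S∈ , _) = ∈-⋃⁻ x∈ in false≢true (trans (sym (𝓜≗∅ S)) S∈)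

  ⋃-∖ᶠ : ∀ (𝓜 : Family n) {X} → X ∈F 𝓜 → ⋃ (𝓜 ∖ᶠ X) ∪ X ≡ ⋃ 𝓜
  ⋃-∖ᶠ 𝓜 {X} X∈ = ⊆-antisym ⊆⋃ ⋃⊆
    where
    ⊆⋃ : ⋃ (𝓜 ∖ᶠ X) ∪ X ⊆ ⋃ 𝓜
    ⊆⋃ x∈ with x∈p∪q⁻ (⋃ (𝓜 ∖ᶠ X)) X x∈
    ... | inj₁ x∈⋃ = let (S , S∈ , x∈S) = ∈-⋃⁻ x∈⋃ in ∈-⋃⁺ (S , proj₁ (∈-∖ᶠ⁻ 𝓜 X S∈) , x∈S)
    ... | inj₂ x∈X = ∈-⋃⁺ (X , X∈ , x∈X)
    ⋃⊆ : ⋃ 𝓜 ⊆ ⋃ (𝓜 ∖ᶠ X) ∪ X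
    ⋃⊆ x∈ with ∈-⋃⁻ x∈
    ... | S , S∈ , x∈S with S ≟ˢ X
    ...   | yes refl = x∈p∪q⁺ (inj₂ x∈S)
    ...   | no  S≢X  = x∈p∪q⁺ (inj₁ (∈-⋃⁺ (S , ∈-∖ᶠ⁺ 𝓜 X S∈ S≢X , x∈S)))

  ⋃-∩-disjoint : ∀ {𝓜 : Family n} {X} → (∀ {S} → S ∈F 𝓜 → Disjoint S X) → ⋃ 𝓜 ∩ X ≡ ⊥
  ⋃-∩-disjoint {𝓜} {X} apart = Disjoint⇒∩≡⊥ λ x x∈⋃ x∈X →
    let (S , S∈ , x∈S) = ∈-⋃⁻ x∈⋃ in apart S∈ x x∈S x∈X

module _ {n : ℕ} (r : Subset n → ℕ) (submodular : ∀ X Y → r (X ∪ Y) + r (X ∩ Y) ≤ r X + r Y) where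

  submodular-⋃ : ∀ 𝓜 → PairwiseDisjoint 𝓜 → ∀ B →
    r (B ∪ ⋃ 𝓜) + ∑ 𝓜 (λ C → r (B ∩ C)) ≤ r B + ∑ 𝓜 r
  submodular-⋃ = family-ind Bound base step
    where
    Bound : Family n → Set
    Bound 𝓜 = PairwiseDisjoint 𝓜 → ∀ B → r (B ∪ ⋃ 𝓜) + ∑ 𝓜 (λ C → r (B ∩ C)) ≤ r B + ∑ 𝓜 r
    base : ∀ {𝓜} → 𝓜 ≗ ∅ᶠ → Bound 𝓜
    base 𝓜≗∅ _ B rewrite ⋃-∅ᶠ 𝓜≗∅ | ∪-identityʳ B | ∑-empty 𝓜≗∅ (λ C → r (B ∩ C)) | ∑-empty 𝓜≗∅ r = ≤-refl
    step : ∀ {𝓜 C} → C ∈F 𝓜 → Bound (𝓜 ∖ᶠ C) → Bound 𝓜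
    step {𝓜} {C} C∈ ih pairwise B = begin
      r (B ∪ ⋃ 𝓜) + ∑ 𝓜 (λ D → r (B ∩ D))
        ≡⟨ cong₂ _+_ (cong r (sym X∪C≡B∪⋃𝓜)) (∑-∖ᶠ 𝓜 C∈) ⟩
      r (X ∪ C) + (r (B ∩ C) + ∑ 𝓜′ (λ D → r (B ∩ D)))
        ≡⟨ cong (λ Y → r (X ∪ C) + (r Y + ∑ 𝓜′ (λ D → r (B ∩ D)))) (sym X∩C≡B∩C) ⟩
      r (X ∪ C) + (r (X ∩ C) + ∑ 𝓜′ (λ D → r (B ∩ D)))
        ≡⟨ sym (+-assoc (r (X ∪ C)) _ _) ⟩
      r (X ∪ C) + r (X ∩ C) + ∑ 𝓜′ (λ D → r (B ∩ D))
        ≤⟨ +-monoˡ-≤ _ (submodular X C) ⟩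
      r X + r C + ∑ 𝓜′ (λ D → r (B ∩ D))
        ≡⟨ xy∙z≈y∙xz (r X) (r C) _ ⟩
      r C + (r X + ∑ 𝓜′ (λ D → r (B ∩ D)))
        ≤⟨ +-monoʳ-≤ (r C) (ih pairwise′ B) ⟩
      r C + (r B + ∑ 𝓜′ r)
        ≡⟨ x∙yz≈y∙xz (r C) (r B) _ ⟩
      r B + (r C + ∑ 𝓜′ r)
        ≡⟨ cong (r B +_) (sym (∑-∖ᶠ 𝓜 C∈)) ⟩
      r B + ∑ 𝓜 r ∎
      where
      open ℕ.≤-Reasoning
      𝓜′ : Family n
      𝓜′ = 𝓜 ∖ᶠ C
      X : Subset n
      X = B ∪ ⋃ 𝓜′
      pairwise′ : PairwiseDisjoint 𝓜′
      pairwise′ D∈ E∈ = pairwise (proj₁ (∈-∖ᶠ⁻ 𝓜 C D∈)) (proj₁ (∈-∖ᶠ⁻ 𝓜 C E∈))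
      X∪C≡B∪⋃𝓜 : X ∪ C ≡ B ∪ ⋃ 𝓜
      X∪C≡B∪⋃𝓜 = trans (∪-assoc B (⋃ 𝓜′) C) (cong (B ∪_) (⋃-∖ᶠ 𝓜 C∈))
      X∩C≡B∩C : X ∩ C ≡ B ∩ C
      X∩C≡B∩C = trans (∩-distribʳ-∪ C B (⋃ 𝓜′))
                (trans (cong ((B ∩ C) ∪_) (⋃-∩-disjoint C∉𝓜′)) (∪-identityʳ (B ∩ C)))
        where
        C∉𝓜′ : ∀ {D} → D ∈F 𝓜′ → Disjoint D C
        C∉𝓜′ D∈ = let (D∈𝓜 , D≢C) = ∈-∖ᶠ⁻ 𝓜 C D∈ in pairwise D∈𝓜 C∈ D≢C

-- Finest common coarsening

module _ {n : ℕ} (𝓢 : Family n) where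

  Compatible : Subset n → Set
  Compatible T = ∀ {S} → S ∈F 𝓢 → Disjoint S T ⊎ S ⊆ T

  record Candidate (T : Subset n) : Set where
    field
      nonempty   : Nonempty T
      ⊆⋃         : T ⊆ ⋃ 𝓢
      compat     : Compatible T

  record Block (C : Subset n) : Set where
    field
      isCandidate : Candidate C
      minimal     : ∀ {T} → Candidate T → T ⊆ C → T ≡ C

  compatible⁻ : ∀ {T} → compatible 𝓢 T ≡ true → Compatible T
  compatible⁻ {T} c {S} S∈ with all-true⁻ _ c (∈-allSubsets S)
  ... | h rewrite S∈ with ∨-true⁻ {disjointᵇ S T} h
  ...   | inj₁ d = inj₁ (disjointᵇ⁻ d)
  ...   | inj₂ s = inj₂ (⊆ᵇ⁻ s)

  compatible⁺ : ∀ {T} → Compatible T → compatible 𝓢 T ≡ true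
  compatible⁺ {T} c = all-true⁺ _ (allSubsets n) holds
    where
    holds : ∀ S → (not (𝓢 S) ∨ disjointᵇ S T ∨ (S ⊆ᵇ T)) ≡ true
    holds S with 𝓢 S in S∈
    ... | false = refl
    ... | true with c S∈
    ...   | inj₁ d = ∨-trueˡ _ (disjointᵇ⁺ d)
    ...   | inj₂ s = ∨-trueʳ (disjointᵇ S T) (⊆ᵇ⁺ s)

  candidate⁻ : ∀ {T} → candidate 𝓢 T ≡ true → Candidate T
  candidate⁻ c with ∧-true⁻ c
  ... | ne , c′ with ∧-true⁻ c′
  ...   | ⊆⋃ , compat = record
    { nonempty = nonemptyᵇ⁻ ne ; ⊆⋃ = ⊆ᵇ⁻ ⊆⋃ ; compat = compatible⁻ compat }

  candidate⁺ : ∀ {T} → Candidate T → candidate 𝓢 T ≡ true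
  candidate⁺ c = ∧-true⁺ (nonemptyᵇ⁺ nonempty) (∧-true⁺ (⊆ᵇ⁺ ⊆⋃) (compatible⁺ compat))
    where open Candidate c

  private
    proper-subcandidate : Subset n → Subset n → Bool
    proper-subcandidate T T′ = candidate 𝓢 T′ ∧ (T′ ⊆ᵇ T) ∧ not (T′ =ˢ T)

    proper-subcandidate⁺ : ∀ {T T′} → Candidate T′ → T′ ⊆ T → T′ ≢ T → proper-subcandidate T T′ ≡ true
    proper-subcandidate⁺ c′ T′⊆T T′≢T = ∧-true⁺ (candidate⁺ c′) (∧-true⁺ (⊆ᵇ⁺ T′⊆T) (not-true⁺ (T′≢T ∘ =ˢ⁻)))

    proper-subcandidate⁻ : ∀ {T T′} → proper-subcandidate T T′ ≡ true → Candidate T′ × T′ ⊂ T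
    proper-subcandidate⁻ p with ∧-true⁻ p
    ... | c′ , p′ with ∧-true⁻ p′
    ...   | T′⊆T , T′≢T = candidate⁻ c′ , ⊆∧≢⇒⊂ (⊆ᵇ⁻ T′⊆T) (not-true⁻ T′≢T ∘ =ˢ⁺)

  fcc⁻ : ∀ {C} → fcc 𝓢 C ≡ true → Block C
  fcc⁻ {C} b with ∧-true⁻ b
  ... | c , no-smaller = record { isCandidate = candidate⁻ c ; minimal = minimal }
    where
    minimal : ∀ {T} → Candidate T → T ⊆ C → T ≡ C
    minimal {T} cT T⊆C with T ≟ˢ C
    ... | yes T≡C = T≡C
    ... | no  T≢C = ⊥-elim (not-true⁻ no-smaller (any-true⁺ _ (∈-allSubsets T) (proper-subcandidate⁺ cT T⊆C T≢C)))

  fcc⁺ : ∀ {C} → Block C → fcc 𝓢 C ≡ true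
  fcc⁺ {C} b = ∧-true⁺ (candidate⁺ isCandidate) (not-true⁺ no-smaller)
    where
    open Block b
    no-smaller : any (proper-subcandidate C) (allSubsets n) ≢ true
    no-smaller h with any-true⁻ _ (allSubsets n) h
    ... | T , p with proper-subcandidate⁻ p
    ...   | cT , T⊆C , x , x∈C , x∉T = x∉T (subst (x ∈_) (sym (minimal cT T⊆C)) x∈C)

  Candidate-∩ : ∀ {C T} → Candidate C → Compatible T → Nonempty (C ∩ T) → Candidate (C ∩ T)
  Candidate-∩ {C} {T} c k ne = record
    { nonempty = ne ; ⊆⋃ = λ x∈ → ⊆⋃ (p∩q⊆p C T x∈) ; compat = compat′ }
    where
    open Candidate c
    compat′ : Compatible (C ∩ T)
    compat′ S∈ with compat S∈ | k S∈
    ... | inj₁ d    | _        = inj₁ λ x x∈S x∈ → d x x∈S (p∩q⊆p C T x∈)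
    ... | inj₂ _    | inj₁ d   = inj₁ λ x x∈S x∈ → d x x∈S (p∩q⊆q C T x∈)
    ... | inj₂ S⊆C  | inj₂ S⊆T = inj₂ λ x∈S → x∈p∩q⁺ (S⊆C x∈S , S⊆T x∈S)

  Candidate-∩∁ : ∀ {C T} → Candidate C → Compatible T → Nonempty (C ∩ ∁ T) → Candidate (C ∩ ∁ T)
  Candidate-∩∁ {C} {T} c k ne = record
    { nonempty = ne ; ⊆⋃ = λ x∈ → ⊆⋃ (p∩q⊆p C (∁ T) x∈) ; compat = compat′ }
    where
    open Candidate c
    compat′ : Compatible (C ∩ ∁ T)
    compat′ S∈ with compat S∈ | k S∈
    ... | inj₁ d    | _        = inj₁ λ x x∈S x∈ → d x x∈S (p∩q⊆p C (∁ T) x∈)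
    ... | inj₂ S⊆C  | inj₁ d   = inj₂ λ {x} x∈S → x∈p∩q⁺ (S⊆C x∈S , x∉p⇒x∈∁p (d x x∈S))
    ... | inj₂ _    | inj₂ S⊆T = inj₁ λ x x∈S x∈ → x∈∁p⇒x∉p (p∩q⊆q C (∁ T) x∈) (S⊆T x∈S)

  block-⊆-or-disjoint : ∀ {C T} → Block C → Compatible T → C ⊆ T ⊎ Disjoint C T
  block-⊆-or-disjoint {C} {T} b k with nonempty? (C ∩ T)
  ... | yes ne = inj₁ λ {x} x∈C → p∩q⊆q C T (subst (x ∈_) (sym C∩T≡C) x∈C)
    where
    C∩T≡C : C ∩ T ≡ C
    C∩T≡C = Block.minimal b (Candidate-∩ (Block.isCandidate b) k ne) (p∩q⊆p C T)
  ... | no ¬ne = inj₂ λ x x∈C x∈T → ¬ne (x , x∈p∩q⁺ (x∈C , x∈T))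

  blocks-disjoint : ∀ {C D} → Block C → Block D → C ≢ D → Disjoint C D
  blocks-disjoint bC bD C≢D with block-⊆-or-disjoint bC (Candidate.compat (Block.isCandidate bD))
  ... | inj₁ C⊆D = ⊥-elim (C≢D (Block.minimal bD (Block.isCandidate bC) C⊆D))
  ... | inj₂ d   = d

  block-or-proper-subcandidate : ∀ {T} → Candidate T → Block T ⊎ ∃ λ T′ → Candidate T′ × T′ ⊂ T
  block-or-proper-subcandidate {T} c with any (proper-subcandidate T) (allSubsets n) in smaller
  ... | true  = let (T′ , p) = any-true⁻ _ (allSubsets n) smaller in inj₂ (T′ , proper-subcandidate⁻ p)
  ... | false = inj₁ (fcc⁻ (∧-true⁺ (candidate⁺ c) (cong not smaller)))

  block-containing : ∀ {x T} → Candidate T → x ∈ T → ∃ λ C → Block C × x ∈ C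
  block-containing {x} {T} = All.wfRec (On.wellFounded ∣_∣ <-wellFounded) 0ℓ P descend T
    where
    P : Subset n → Set
    P T = Candidate T → x ∈ T → ∃ λ C → Block C × x ∈ C
    descend : ∀ T → (∀ {T′} → ∣ T′ ∣ < ∣ T ∣ → P T′) → P T
    descend T smaller c x∈T with block-or-proper-subcandidate c
    ... | inj₁ b = T , b , x∈T
    ... | inj₂ (T′ , c′ , T′⊂T) with x ∈? T′
    ...   | yes x∈T′ = smaller (p⊂q⇒∣p∣<∣q∣ T′⊂T) c′ x∈T′
    ...   | no  x∉T′ = smaller (p⊂q⇒∣p∣<∣q∣ (∩∁-⊂ (proj₁ T′⊂T) (Candidate.nonempty c′)))
                         (Candidate-∩∁ c (Candidate.compat c′) (x , x∈T∖T′)) x∈T∖T′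
      where
      x∈T∖T′ : x ∈ T ∩ ∁ T′
      x∈T∖T′ = x∈p∩q⁺ (x∈T , x∉p⇒x∈∁p x∉T′)

  ⋃-candidate : Nonempty (⋃ 𝓢) → Candidate (⋃ 𝓢)
  ⋃-candidate ne = record
    { nonempty = ne ; ⊆⋃ = λ x∈ → x∈ ; compat = λ S∈ → inj₂ λ x∈S → ∈-⋃⁺ (_ , S∈ , x∈S) }

  block-containing-⋃ : ∀ {x} → x ∈ ⋃ 𝓢 → ∃ λ C → Block C × x ∈ C
  block-containing-⋃ {x} x∈ = block-containing (⋃-candidate (x , x∈)) x∈

  block-containing-member : ∀ {S} → S ∈F 𝓢 → Nonempty S → ∃ λ C → Block C × S ⊆ C
  block-containing-member S∈ (x , x∈S) with block-containing-⋃ (∈-⋃⁺ (_ , S∈ , x∈S))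
  ... | C , b , x∈C with Candidate.compat (Block.isCandidate b) S∈
  ...   | inj₁ d   = ⊥-elim (d x x∈S x∈C)
  ...   | inj₂ S⊆C = C , b , S⊆C

  fcc-partition : IsPartition (fcc 𝓢) (⋃ 𝓢)
  fcc-partition = record
    { nonempty = λ C C∈ → Candidate.nonempty (Block.isCandidate (fcc⁻ C∈))
    ; disjoint = λ C D C∈ D∈ C≢D → Disjoint⇒∩≡⊥ (blocks-disjoint (fcc⁻ C∈) (fcc⁻ D∈) C≢D)
    ; covers   = λ x → mk⇔ (λ x∈ → let (C , b , x∈C) = block-containing-⋃ x∈ in C , fcc⁺ b , x∈C)
                           (λ (C , C∈ , x∈C) → Candidate.⊆⋃ (Block.isCandidate (fcc⁻ C∈)) x∈C)
    }

  fcc-unique : (𝓑 : Family n) →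
    (∀ {D} → D ∈F 𝓑 → Candidate D) →
    (∀ {D T} → D ∈F 𝓑 → Candidate T → D ⊆ T ⊎ Disjoint D T) →
    (∀ {x} → x ∈ ⋃ 𝓢 → x ∈⋃ 𝓑) →
    fcc 𝓢 ≗ 𝓑
  fcc-unique 𝓑 candidates splitting covering T = ≡true-ext to from
    where
    to : T ∈F fcc 𝓢 → T ∈F 𝓑
    to T∈ with fcc⁻ T∈
    ... | b with Block.isCandidate b
    ...   | c with Candidate.nonempty c
    ...     | (x , x∈T) with covering (Candidate.⊆⋃ c x∈T)
    ...       | D , D∈ , x∈D with splitting D∈ c
    ...         | inj₁ D⊆T = subst (_∈F 𝓑) (Block.minimal b (candidates D∈) D⊆T) D∈
    ...         | inj₂ d   = ⊥-elim (d x x∈D x∈T)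
    from : T ∈F 𝓑 → T ∈F fcc 𝓢
    from T∈ = fcc⁺ (record { isCandidate = candidates T∈ ; minimal = minimal })
      where
      minimal : ∀ {T′} → Candidate T′ → T′ ⊆ T → T′ ≡ T
      minimal c′ T′⊆T with splitting T∈ c′ | Candidate.nonempty c′
      ... | inj₁ T⊆T′ | _          = ⊆-antisym T′⊆T T⊆T′
      ... | inj₂ d    | (x , x∈T′) = ⊥-elim (d x (T′⊆T x∈T′) x∈T′)

module _ {n : ℕ} where

  avoiding : Family n → Subset n → Family n
  avoiding 𝓕 X T = 𝓕 T ∧ disjointᵇ T X

  meeting : Family n → Subset n → Family n
  meeting 𝓕 X T = 𝓕 T ∧ not (disjointᵇ T X)

  avoiding∪meeting : ∀ (𝓕 : Family n) X → 𝓕 ≗ avoiding 𝓕 X ∪ᶠ meeting 𝓕 X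
  avoiding∪meeting 𝓕 X T with 𝓕 T | disjointᵇ T X
  ... | true  | true  = refl
  ... | true  | false = refl
  ... | false | _     = refl

  ∈-avoiding⁻ : ∀ (𝓕 : Family n) X {T} → T ∈F avoiding 𝓕 X → T ∈F 𝓕 × Disjoint T X
  ∈-avoiding⁻ 𝓕 X T∈ = proj₁ (∧-true⁻ T∈) , disjointᵇ⁻ (proj₂ (∧-true⁻ {𝓕 _} T∈))

  ∈-avoiding⁺ : ∀ (𝓕 : Family n) X {T} → T ∈F 𝓕 → Disjoint T X → T ∈F avoiding 𝓕 X
  ∈-avoiding⁺ _ _ T∈ d = ∧-true⁺ T∈ (disjointᵇ⁺ d)

  ∈-meeting⁻ : ∀ (𝓕 : Family n) X {T} → T ∈F meeting 𝓕 X → T ∈F 𝓕 × Nonempty (T ∩ X)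
  ∈-meeting⁻ 𝓕 X T∈ = proj₁ (∧-true⁻ T∈) , meetsᵇ⁻ (proj₂ (∧-true⁻ {𝓕 _} T∈))

  ∈-meeting⁺ : ∀ (𝓕 : Family n) X {T} → T ∈F 𝓕 → Nonempty (T ∩ X) → T ∈F meeting 𝓕 X
  ∈-meeting⁺ _ _ T∈ ne = ∧-true⁺ T∈ (meetsᵇ⁺ ne)

  avoiding-meeting-apart : ∀ (𝓕 : Family n) X T → T ∈F avoiding 𝓕 X → T ∈F meeting 𝓕 X → ∅
  avoiding-meeting-apart 𝓕 X T T∈ T∈′ =
    let (x , x∈) = proj₂ (∈-meeting⁻ 𝓕 X T∈′) in
    proj₂ (∈-avoiding⁻ 𝓕 X T∈) x (p∩q⊆p T X x∈) (p∩q⊆q T X x∈)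

module _ {n : ℕ} {𝓟 : Family n} {S : Subset n} (p : IsPartition 𝓟 S) where

  open IsPartition p

  part⊆ : ∀ {P} → P ∈F 𝓟 → P ⊆ S
  part⊆ P∈ x∈P = Equivalence.from (covers _) (_ , P∈ , x∈P)

  part-containing : ∀ {x} → x ∈ S → x ∈⋃ 𝓟
  part-containing x∈ = Equivalence.to (covers _) x∈

  parts-disjoint : PairwiseDisjoint 𝓟
  parts-disjoint P∈ Q∈ P≢Q = ∩≡⊥⇒Disjoint (disjoint _ _ P∈ Q∈ P≢Q)

  partition-∖ᶠ : ∀ {B} → B ∈F 𝓟 → IsPartition (𝓟 ∖ᶠ B) (S ∩ ∁ B)
  partition-∖ᶠ {B} B∈ = record
    { nonempty = λ T T∈ → nonempty T (proj₁ (∈-∖ᶠ⁻ 𝓟 B T∈))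
    ; disjoint = λ T T′ T∈ T′∈ → disjoint T T′ (proj₁ (∈-∖ᶠ⁻ 𝓟 B T∈)) (proj₁ (∈-∖ᶠ⁻ 𝓟 B T′∈))
    ; covers   = λ x → mk⇔ to from
    }
    where
    to : ∀ {x} → x ∈ S ∩ ∁ B → x ∈⋃ (𝓟 ∖ᶠ B)
    to x∈ with part-containing (p∩q⊆p S (∁ B) x∈)
    ... | P , P∈ , x∈P with P ≟ˢ B
    ...   | yes refl = ⊥-elim (x∈∁p⇒x∉p (p∩q⊆q S (∁ B) x∈) x∈P)
    ...   | no  P≢B  = P , ∈-∖ᶠ⁺ 𝓟 B P∈ P≢B , x∈P
    from : ∀ {x} → x ∈⋃ (𝓟 ∖ᶠ B) → x ∈ S ∩ ∁ B
    from {x} (P , P∈ , x∈P) = let (P∈𝓟 , P≢B) = ∈-∖ᶠ⁻ 𝓟 B P∈ in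
      x∈p∩q⁺ (part⊆ P∈𝓟 x∈P , x∉p⇒x∈∁p (parts-disjoint P∈𝓟 B∈ P≢B x x∈P))

  fcc-of-partition : ∀ {𝓢} → 𝓢 ≗ 𝓟 → fcc 𝓢 ≗ 𝓟
  fcc-of-partition {𝓢} 𝓢≗𝓟 = fcc-unique 𝓢 𝓟 candidates splitting covering
    where
    into : ∀ {T} → T ∈F 𝓟 → T ∈F 𝓢
    into {T} T∈ = trans (𝓢≗𝓟 T) T∈
    candidates : ∀ {D} → D ∈F 𝓟 → Candidate 𝓢 D
    candidates {D} D∈ = record
      { nonempty = nonempty D D∈
      ; ⊆⋃       = λ x∈D → ∈-⋃⁺ (D , into D∈ , x∈D)
      ; compat   = λ {E} E∈ → case E ≟ˢ D of λ where
          (yes refl) → inj₂ (λ {_} x∈ → x∈)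
          (no  E≢D)  → inj₁ (parts-disjoint (trans (sym (𝓢≗𝓟 E)) E∈) D∈ E≢D)
      }
    splitting : ∀ {D T} → D ∈F 𝓟 → Candidate 𝓢 T → D ⊆ T ⊎ Disjoint D T
    splitting D∈ c with Candidate.compat c (into D∈)
    ... | inj₁ d   = inj₂ d
    ... | inj₂ D⊆T = inj₁ D⊆T
    covering : ∀ {x} → x ∈ ⋃ 𝓢 → x ∈⋃ 𝓟
    covering x∈ = let (D , D∈ , x∈D) = ∈-⋃⁻ x∈ in D , trans (sym (𝓢≗𝓟 D)) D∈ , x∈D

module _ {n : ℕ} where

  ∅ᶠ-partition : ∀ {S : Subset n} → (∀ {x} → x ∉ S) → IsPartition ∅ᶠ S
  ∅ᶠ-partition S-empty = record
    { nonempty = λ _ ()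
    ; disjoint = λ _ _ ()
    ; covers   = λ x → mk⇔ (⊥-elim ∘ S-empty) λ ()
    }

  partitions-apart : ∀ {𝓐 𝓑 : Family n} {A B} → IsPartition 𝓐 A → IsPartition 𝓑 B → Disjoint A B →
    ∀ T → T ∈F 𝓐 → T ∈F 𝓑 → ∅
  partitions-apart pA pB A-apart T T∈𝓐 T∈𝓑 =
    let (x , x∈T) = IsPartition.nonempty pA T T∈𝓐 in A-apart x (part⊆ pA T∈𝓐 x∈T) (part⊆ pB T∈𝓑 x∈T)

  partition-∪ᶠ : ∀ {𝓐 𝓑 : Family n} {A B} → IsPartition 𝓐 A → IsPartition 𝓑 B → Disjoint A B →
    IsPartition (𝓐 ∪ᶠ 𝓑) (A ∪ B)
  partition-∪ᶠ {𝓐} {𝓑} {A} {B} pA pB A-apart = record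
    { nonempty = λ T T∈ → [ IsPartition.nonempty pA T , IsPartition.nonempty pB T ]′ (∨-true⁻ {𝓐 T} T∈)
    ; disjoint = disjoint
    ; covers   = λ x → mk⇔ to from
    }
    where
    disjoint : ∀ T T′ → T ∈F (𝓐 ∪ᶠ 𝓑) → T′ ∈F (𝓐 ∪ᶠ 𝓑) → T ≢ T′ → T ∩ T′ ≡ ⊥
    disjoint T T′ T∈ T′∈ T≢T′ with ∨-true⁻ {𝓐 T} T∈ | ∨-true⁻ {𝓐 T′} T′∈
    ... | inj₁ T∈𝓐 | inj₁ T′∈𝓐 = IsPartition.disjoint pA T T′ T∈𝓐 T′∈𝓐 T≢T′
    ... | inj₂ T∈𝓑 | inj₂ T′∈𝓑 = IsPartition.disjoint pB T T′ T∈𝓑 T′∈𝓑 T≢T′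
    ... | inj₁ T∈𝓐 | inj₂ T′∈𝓑 = Disjoint⇒∩≡⊥ λ x x∈T x∈T′ → A-apart x (part⊆ pA T∈𝓐 x∈T) (part⊆ pB T′∈𝓑 x∈T′)
    ... | inj₂ T∈𝓑 | inj₁ T′∈𝓐 = Disjoint⇒∩≡⊥ λ x x∈T x∈T′ → A-apart x (part⊆ pA T′∈𝓐 x∈T′) (part⊆ pB T∈𝓑 x∈T)
    to : ∀ {x} → x ∈ A ∪ B → x ∈⋃ (𝓐 ∪ᶠ 𝓑)
    to x∈ with x∈p∪q⁻ A B x∈
    ... | inj₁ x∈A = let (T , T∈ , x∈T) = part-containing pA x∈A in T , ∨-trueˡ (𝓑 T) T∈ , x∈T
    ... | inj₂ x∈B = let (T , T∈ , x∈T) = part-containing pB x∈B in T , ∨-trueʳ (𝓐 T) T∈ , x∈T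
    from : ∀ {x} → x ∈⋃ (𝓐 ∪ᶠ 𝓑) → x ∈ A ∪ B
    from (T , T∈ , x∈T) with ∨-true⁻ {𝓐 T} T∈
    ... | inj₁ T∈𝓐 = x∈p∪q⁺ (inj₁ (part⊆ pA T∈𝓐 x∈T))
    ... | inj₂ T∈𝓑 = x∈p∪q⁺ (inj₂ (part⊆ pB T∈𝓑 x∈T))

  trace : Family n → Subset n → Family n
  trace 𝓒 B = image (B ∩_) (meeting 𝓒 B)

  ∈-trace⁺ : ∀ (𝓒 : Family n) B {C} → C ∈F 𝓒 → Nonempty (C ∩ B) → (B ∩ C) ∈F trace 𝓒 B
  ∈-trace⁺ 𝓒 B C∈ ne = ∈-image⁺ (B ∩_) (meeting 𝓒 B) (∈-meeting⁺ 𝓒 B C∈ ne)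

module _ {n : ℕ} {𝓒 : Family n} {U : Subset n} (p : IsPartition 𝓒 U) (B : Subset n) where

  private
    ∩-swap : ∀ {x C} → x ∈ C ∩ B → x ∈ B ∩ C
    ∩-swap {x} {C} x∈ = x∈p∩q⁺ (p∩q⊆q C B x∈ , p∩q⊆p C B x∈)

    ∩-injective : InjectiveOn (B ∩_) (meeting 𝓒 B)
    ∩-injective {C} {C′} C∈ C′∈ B∩C≡B∩C′ with C ≟ˢ C′
    ... | yes C≡C′ = C≡C′
    ... | no  C≢C′ =
      let (C∈𝓒 , (y , y∈C∩B)) = ∈-meeting⁻ 𝓒 B C∈ ; y∈B∩C′ = subst (y ∈_) B∩C≡B∩C′ (∩-swap y∈C∩B) in
      ⊥-elim (parts-disjoint p C∈𝓒 (proj₁ (∈-meeting⁻ 𝓒 B C′∈)) C≢C′ y (p∩q⊆p C B y∈C∩B) (p∩q⊆q B C′ y∈B∩C′))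

  ∑-trace : ∀ f → ∑ (trace 𝓒 B) f ≡ ∑ (meeting 𝓒 B) (f ∘ (B ∩_))
  ∑-trace f = ∑-image (B ∩_) (meeting 𝓒 B) ∩-injective

  trace-partition : IsPartition (trace 𝓒 B) (B ∩ U)
  trace-partition = record { nonempty = nonempty ; disjoint = disjoint ; covers = λ x → mk⇔ to from }
    where
    nonempty : ∀ T → T ∈F trace 𝓒 B → Nonempty T
    nonempty T T∈ with ∈-image⁻ (B ∩_) (meeting 𝓒 B) T∈
    ... | C , C∈ , refl = let (y , y∈C∩B) = proj₂ (∈-meeting⁻ 𝓒 B C∈) in y , ∩-swap y∈C∩B
    disjoint : ∀ T T′ → T ∈F trace 𝓒 B → T′ ∈F trace 𝓒 B → T ≢ T′ → T ∩ T′ ≡ ⊥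
    disjoint T T′ T∈ T′∈ T≢T′ with ∈-image⁻ (B ∩_) (meeting 𝓒 B) T∈ | ∈-image⁻ (B ∩_) (meeting 𝓒 B) T′∈
    ... | C , C∈ , refl | C′ , C′∈ , refl = Disjoint⇒∩≡⊥ λ x x∈B∩C x∈B∩C′ →
      parts-disjoint p (proj₁ (∈-meeting⁻ 𝓒 B C∈)) (proj₁ (∈-meeting⁻ 𝓒 B C′∈)) (T≢T′ ∘ cong (B ∩_))
                     x (p∩q⊆q B C x∈B∩C) (p∩q⊆q B C′ x∈B∩C′)
    to : ∀ {x} → x ∈ B ∩ U → x ∈⋃ trace 𝓒 B
    to {x} x∈ = let (C , C∈ , x∈C) = part-containing p (p∩q⊆q B U x∈) ; x∈B = p∩q⊆p B U x∈ in
      B ∩ C , ∈-trace⁺ 𝓒 B C∈ (x , x∈p∩q⁺ (x∈C , x∈B)) , x∈p∩q⁺ (x∈B , x∈C)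
    from : ∀ {x} → x ∈⋃ trace 𝓒 B → x ∈ B ∩ U
    from (T , T∈ , x∈T) with ∈-image⁻ (B ∩_) (meeting 𝓒 B) T∈
    ... | C , C∈ , refl = x∈p∩q⁺ (p∩q⊆p B C x∈T , part⊆ p (proj₁ (∈-meeting⁻ 𝓒 B C∈)) (p∩q⊆q B C x∈T))

-- Adjoining a set to a family

module _ {n : ℕ} (𝓢 : Family n) (X : Subset n) where

  hull : Subset n
  hull = X ∪ ⋃ (meeting (fcc 𝓢) X)

  X⊆hull : X ⊆ hull
  X⊆hull x∈X = x∈p∪q⁺ (inj₁ x∈X)

  block⊆hull : ∀ {C} → Block 𝓢 C → Nonempty (C ∩ X) → C ⊆ hull
  block⊆hull b ne x∈C = x∈p∪q⁺ (inj₂ (∈-⋃⁺ (_ , ∈-meeting⁺ (fcc 𝓢) X (fcc⁺ 𝓢 b) ne , x∈C)))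

  ∈-hull⁻ : ∀ {x} → x ∈ hull → x ∈ X ⊎ ∃ λ C → Block 𝓢 C × Nonempty (C ∩ X) × x ∈ C
  ∈-hull⁻ x∈ with x∈p∪q⁻ X _ x∈
  ... | inj₁ x∈X = inj₁ x∈X
  ... | inj₂ x∈⋃ = let (C , C∈ , x∈C) = ∈-⋃⁻ x∈⋃ ; (C∈fcc , ne) = ∈-meeting⁻ (fcc 𝓢) X C∈ in
                   inj₂ (C , fcc⁻ 𝓢 C∈fcc , ne , x∈C)

module _ {n : ℕ} {𝓢 𝓢′ : Family n} {X : Subset n} (X-nonempty : Nonempty X)
         (adjoined : ∀ {T} → T ∈F 𝓢′ ⇔ (T ∈F 𝓢 ⊎ T ≡ X)) where

  private
    K : Subset n
    K = hull 𝓢 X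

    member⁻ : ∀ {T} → T ∈F 𝓢′ → T ∈F 𝓢 ⊎ T ≡ X
    member⁻ = Equivalence.to adjoined

    old-member : ∀ {T} → T ∈F 𝓢 → T ∈F 𝓢′
    old-member T∈ = Equivalence.from adjoined (inj₁ T∈)

    X-member : X ∈F 𝓢′
    X-member = Equivalence.from adjoined (inj₂ refl)

    ⋃-mono : ∀ {x} → x ∈ ⋃ 𝓢 → x ∈ ⋃ 𝓢′
    ⋃-mono x∈ = let (S , S∈ , x∈S) = ∈-⋃⁻ x∈ in ∈-⋃⁺ (S , old-member S∈ , x∈S)

    Compatible-restrict : ∀ {T} → Compatible 𝓢′ T → Compatible 𝓢 T
    Compatible-restrict k S∈ = k (old-member S∈)

    hull-candidate : Candidate 𝓢′ K
    hull-candidate = record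
      { nonempty = proj₁ X-nonempty , X⊆hull 𝓢 X (proj₂ X-nonempty)
      ; ⊆⋃       = ⊆⋃
      ; compat   = compat
      }
      where
      ⊆⋃ : K ⊆ ⋃ 𝓢′
      ⊆⋃ x∈ with ∈-hull⁻ 𝓢 X x∈
      ... | inj₁ x∈X               = ∈-⋃⁺ (X , X-member , x∈X)
      ... | inj₂ (C , b , _ , x∈C) = ⋃-mono (Candidate.⊆⋃ (Block.isCandidate b) x∈C)
      compat : Compatible 𝓢′ K
      compat S∈ with member⁻ S∈
      ... | inj₂ refl = inj₂ (X⊆hull 𝓢 X)
      ... | inj₁ S∈𝓢 with nonempty? _
      ...   | no ¬ne = inj₁ λ x x∈S _ → ¬ne (x , x∈S)
      ...   | yes ne with block-containing-member 𝓢 S∈𝓢 ne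
      ...     | C , b , S⊆C with nonempty? (C ∩ X)
      ...       | yes C∩X = inj₂ λ x∈S → block⊆hull 𝓢 X b C∩X (S⊆C x∈S)
      ...       | no ¬C∩X = inj₁ λ x x∈S x∈K → C-apart x (S⊆C x∈S) x∈K
        where
        C-apart : Disjoint C K
        C-apart x x∈C x∈K with ∈-hull⁻ 𝓢 X x∈K
        ... | inj₁ x∈X = ¬C∩X (x , x∈p∩q⁺ (x∈C , x∈X))
        ... | inj₂ (C′ , b′ , C′∩X , x∈C′) with C ≟ˢ C′
        ...   | yes refl = ¬C∩X C′∩X
        ...   | no  C≢C′ = blocks-disjoint 𝓢 b b′ C≢C′ x x∈C x∈C′

    hull-⊆-or-disjoint : ∀ {T} → Candidate 𝓢′ T → K ⊆ T ⊎ Disjoint K T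
    hull-⊆-or-disjoint {T} c with Candidate.compat c X-member
    ... | inj₂ X⊆T = inj₁ K⊆T
      where
      K⊆T : K ⊆ T
      K⊆T x∈K with ∈-hull⁻ 𝓢 X x∈K
      ... | inj₁ x∈X = X⊆T x∈X
      ... | inj₂ (C , b , (y , y∈C∩X) , x∈C) with block-⊆-or-disjoint 𝓢 b (Compatible-restrict (Candidate.compat c))
      ...   | inj₁ C⊆T = C⊆T x∈C
      ...   | inj₂ d   = ⊥-elim (d y (p∩q⊆p _ X y∈C∩X) (X⊆T (p∩q⊆q _ X y∈C∩X)))
    ... | inj₁ X-apart = inj₂ K-apart
      where
      K-apart : Disjoint K T
      K-apart x x∈K x∈T with ∈-hull⁻ 𝓢 X x∈K
      ... | inj₁ x∈X = X-apart x x∈X x∈T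
      ... | inj₂ (C , b , (y , y∈C∩X) , x∈C) with block-⊆-or-disjoint 𝓢 b (Compatible-restrict (Candidate.compat c))
      ...   | inj₁ C⊆T = X-apart y (p∩q⊆q _ X y∈C∩X) (C⊆T (p∩q⊆p _ X y∈C∩X))
      ...   | inj₂ d   = d x x∈C x∈T

  fcc-adjoin : fcc 𝓢′ ≗ avoiding (fcc 𝓢) X ∪ᶠ ⁅ K ⁆ᶠ
  fcc-adjoin = fcc-unique 𝓢′ _ candidates splitting covering
    where
    candidates : ∀ {D} → D ∈F (avoiding (fcc 𝓢) X ∪ᶠ ⁅ K ⁆ᶠ) → Candidate 𝓢′ D
    candidates {D} D∈ with ∨-true⁻ {avoiding (fcc 𝓢) X D} D∈
    ... | inj₂ D≡K = subst (Candidate 𝓢′) (sym (=ˢ⁻ D≡K)) hull-candidate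
    ... | inj₁ D∈′ = record
      { nonempty = Candidate.nonempty c
      ; ⊆⋃       = ⋃-mono ∘ Candidate.⊆⋃ c
      ; compat   = λ S∈ → case member⁻ S∈ of λ where
          (inj₁ S∈𝓢) → Candidate.compat c S∈𝓢
          (inj₂ refl) → inj₁ (Disjoint-sym D-apart)
      }
      where
      c : Candidate 𝓢 D
      c = Block.isCandidate (fcc⁻ 𝓢 (proj₁ (∈-avoiding⁻ (fcc 𝓢) X D∈′)))
      D-apart : Disjoint D X
      D-apart = proj₂ (∈-avoiding⁻ (fcc 𝓢) X D∈′)
    splitting : ∀ {D T} → D ∈F (avoiding (fcc 𝓢) X ∪ᶠ ⁅ K ⁆ᶠ) → Candidate 𝓢′ T → D ⊆ T ⊎ Disjoint D T
    splitting {D} D∈ c with ∨-true⁻ {avoiding (fcc 𝓢) X D} D∈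
    ... | inj₁ D∈′ = block-⊆-or-disjoint 𝓢 (fcc⁻ 𝓢 (proj₁ (∈-avoiding⁻ (fcc 𝓢) X D∈′)))
                                           (Compatible-restrict (Candidate.compat c))
    ... | inj₂ D≡K rewrite =ˢ⁻ D≡K = hull-⊆-or-disjoint c
    covering : ∀ {x} → x ∈ ⋃ 𝓢′ → x ∈⋃ (avoiding (fcc 𝓢) X ∪ᶠ ⁅ K ⁆ᶠ)
    covering x∈ with ∈-⋃⁻ x∈
    ... | S , S∈ , x∈S with member⁻ S∈
    ...   | inj₂ refl = K , ∨-trueʳ (avoiding (fcc 𝓢) X K) (=ˢ⁺ {A = K} refl) , X⊆hull 𝓢 X x∈S
    ...   | inj₁ S∈𝓢 with block-containing-⋃ 𝓢 (∈-⋃⁺ (S , S∈𝓢 , x∈S))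
    ...     | C , b , x∈C with nonempty? (C ∩ X)
    ...       | yes ne = K , ∨-trueʳ (avoiding (fcc 𝓢) X K) (=ˢ⁺ {A = K} refl) , block⊆hull 𝓢 X b ne x∈C
    ...       | no ¬ne = C , ∨-trueˡ _ (∈-avoiding⁺ (fcc 𝓢) X (fcc⁺ 𝓢 b) C-apart) , x∈C
      where
      C-apart : Disjoint C X
      C-apart y y∈C y∈X = ¬ne (y , x∈p∩q⁺ (y∈C , y∈X))

-- The induction on the parts of the second partition

private
  rearrange-≤ : ∀ a m q h s p b a′ → (a + m) + q ≤ p + a′ → h + s ≤ b + m → (a + h) + (q + s) ≤ p + (b + a′)
  rearrange-≤ a m q h s p b a′ ih sub = ℕ.+-cancelʳ-≤ m _ _ (begin
    (a + h) + (q + s) + m    ≡⟨ lhs a m q h s ⟩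
    ((a + m) + q) + (h + s)  ≤⟨ +-mono-≤ ih sub ⟩
    (p + a′) + (b + m)       ≡⟨ rhs p a′ b m ⟩
    p + (b + a′) + m         ∎)
    where
    open ℕ.≤-Reasoning
    lhs : ∀ a m q h s → (a + h) + (q + s) + m ≡ ((a + m) + q) + (h + s)
    lhs = solve-∀
    rhs : ∀ p a′ b m → (p + a′) + (b + m) ≡ p + (b + a′) + m
    rhs = solve-∀

  rearrange-≡ : ∀ p a′ a m q → p + a′ ≡ (a + m) + q → p + (1 + a′) ≡ (a + 1) + (q + m)
  rearrange-≡ p a′ a m q ih = begin
    p + (1 + a′)       ≡⟨ lhs p a′ ⟩
    1 + (p + a′)       ≡⟨ cong (1 +_) ih ⟩
    1 + ((a + m) + q)  ≡⟨ rhs a m q ⟩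
    (a + 1) + (q + m)  ∎
    where
    open ≡-Reasoning
    lhs : ∀ p a′ → p + (1 + a′) ≡ 1 + (p + a′)
    lhs = solve-∀
    rhs : ∀ a m q → 1 + ((a + m) + q) ≡ (a + 1) + (q + m)
    rhs = solve-∀

module _ {n : ℕ} (r : Subset n → ℕ) (submodular : ∀ X Y → r (X ∪ Y) + r (X ∩ Y) ≤ r X + r Y)
         {𝓟 : Family n} {S : Subset n} (pP : IsPartition 𝓟 S) where

  record MeetWitness (𝓐 : Family n) (A : Subset n) : Set where
    field
      𝓠             : Family n
      partition     : IsPartition 𝓠 (S ∩ A)
      rank-bound    : ∑ (fcc (𝓟 ∪ᶠ 𝓐)) r + ∑ 𝓠 r ≤ ∑ 𝓟 r + ∑ 𝓐 r
      coarsens-meet : ∀ {P A′} → P ∈F 𝓟 → A′ ∈F 𝓐 → Nonempty (P ∩ A′) → ∃ λ Q → Q ∈F 𝓠 × P ∩ A′ ⊆ Q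
      count         : # 𝓟 + # 𝓐 ≡ # (fcc (𝓟 ∪ᶠ 𝓐)) + # 𝓠

  meet-witness-∅ᶠ : ∀ {𝓐} → 𝓐 ≗ ∅ᶠ → ∀ {A} → IsPartition 𝓐 A → MeetWitness 𝓐 A
  meet-witness-∅ᶠ {𝓐} 𝓐≗∅ {A} pA = record
    { 𝓠             = ∅ᶠ
    ; partition     = ∅ᶠ-partition λ x∈ → let (T , T∈ , _) = part-containing pA (p∩q⊆q S A x∈) in not-member T T∈
    ; rank-bound    = ℕ.≤-reflexive (sym (sums r))
    ; coarsens-meet = λ _ A′∈ → ⊥-elim (not-member _ A′∈)
    ; count         = trans (cong₂ _+_ (#≡∑1 𝓟) (#≡∑1 𝓐))
                            (trans (sums (λ _ → 1)) (sym (cong₂ _+_ (#≡∑1 J) (#≡∑1 (∅ᶠ {n})))))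
    }
    where
    J : Family n
    J = fcc (𝓟 ∪ᶠ 𝓐)
    not-member : ∀ T → T ∈F 𝓐 → ∅
    not-member T T∈ = false≢true (trans (sym (𝓐≗∅ T)) T∈)
    J≗𝓟 : J ≗ 𝓟
    J≗𝓟 = fcc-of-partition pP λ T → trans (cong (𝓟 T ∨_) (𝓐≗∅ T)) (∨-identityʳ (𝓟 T))
    sums : ∀ f → ∑ 𝓟 f + ∑ 𝓐 f ≡ ∑ J f + ∑ ∅ᶠ f
    sums f rewrite ∑-empty {𝓜 = ∅ᶠ} (λ _ → refl) f | ∑-empty 𝓐≗∅ f | ∑-cong {f = f} J≗𝓟 = refl

  module AdjoinPart {𝓐 B A} (B∈ : B ∈F 𝓐) (pA : IsPartition 𝓐 A) (w : MeetWitness (𝓐 ∖ᶠ B) (A ∩ ∁ B)) where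

    open MeetWitness w renaming
      (𝓠 to 𝓠′; partition to pQ′; rank-bound to rank-bound′; coarsens-meet to coarsens-meet′; count to count′)

    𝓐′ : Family n
    𝓐′ = 𝓐 ∖ᶠ B

    𝓢 : Family n
    𝓢 = 𝓟 ∪ᶠ 𝓐′

    𝓜 : Family n
    𝓜 = meeting (fcc 𝓢) B

    𝓠 : Family n
    𝓠 = 𝓠′ ∪ᶠ trace (fcc 𝓢) B

    ∉B : ∀ {x} → x ∈ A ∩ ∁ B → x ∉ B
    ∉B x∈ = x∈∁p⇒x∉p (p∩q⊆q A (∁ B) x∈)

    apart : Disjoint (S ∩ (A ∩ ∁ B)) (B ∩ ⋃ 𝓢)
    apart x x∈ x∈′ = ∉B (p∩q⊆q S _ x∈) (p∩q⊆p B _ x∈′)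

    adjoined : ∀ {T} → T ∈F (𝓟 ∪ᶠ 𝓐) ⇔ (T ∈F 𝓢 ⊎ T ≡ B)
    adjoined {T} = mk⇔ to from
      where
      to : T ∈F (𝓟 ∪ᶠ 𝓐) → T ∈F 𝓢 ⊎ T ≡ B
      to T∈ with ∨-true⁻ {𝓟 T} T∈
      ... | inj₁ T∈𝓟 = inj₁ (∨-trueˡ (𝓐′ T) T∈𝓟)
      ... | inj₂ T∈𝓐 = case T ≟ˢ B of λ where
        (yes T≡B) → inj₂ T≡B
        (no  T≢B) → inj₁ (∨-trueʳ (𝓟 T) (∈-∖ᶠ⁺ 𝓐 B T∈𝓐 T≢B))
      from : T ∈F 𝓢 ⊎ T ≡ B → T ∈F (𝓟 ∪ᶠ 𝓐)
      from (inj₂ refl) = ∨-trueʳ (𝓟 B) B∈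
      from (inj₁ T∈) with ∨-true⁻ {𝓟 T} T∈
      ... | inj₁ T∈𝓟  = ∨-trueˡ (𝓐 T) T∈𝓟
      ... | inj₂ T∈𝓐′ = ∨-trueʳ (𝓟 T) (proj₁ (∈-∖ᶠ⁻ 𝓐 B T∈𝓐′))

    ∑-fcc : ∀ f → ∑ (fcc 𝓢) f ≡ ∑ (avoiding (fcc 𝓢) B) f + ∑ 𝓜 f
    ∑-fcc f = trans (∑-cong (avoiding∪meeting (fcc 𝓢) B)) (∑-∪ᶠ _ _ (avoiding-meeting-apart (fcc 𝓢) B))

    ∑-fcc-adjoined : ∀ f → ∑ (fcc (𝓟 ∪ᶠ 𝓐)) f ≡ ∑ (avoiding (fcc 𝓢) B) f + f (hull 𝓢 B)
    ∑-fcc-adjoined f =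
      trans (∑-cong (fcc-adjoin (IsPartition.nonempty pA B B∈) adjoined))
            (trans (∑-∪ᶠ _ _ hull-apart) (cong (∑ (avoiding (fcc 𝓢) B) f +_) (∑-⁅⁆ᶠ (hull 𝓢 B))))
      where
      hull-apart : ∀ T → T ∈F avoiding (fcc 𝓢) B → T ∈F ⁅ hull 𝓢 B ⁆ᶠ → ∅
      hull-apart T T∈ T≡hull with =ˢ⁻ T≡hull
      ... | refl = let (x , x∈B) = IsPartition.nonempty pA B B∈ in
                   proj₂ (∈-avoiding⁻ (fcc 𝓢) B T∈) x (X⊆hull 𝓢 B x∈B) x∈B

    ∑-𝓠 : ∀ f → ∑ 𝓠 f ≡ ∑ 𝓠′ f + ∑ 𝓜 (f ∘ (B ∩_))
    ∑-𝓠 f = trans (∑-∪ᶠ _ _ (partitions-apart pQ′ (trace-partition (fcc-partition 𝓢) B) apart))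
                  (cong (∑ 𝓠′ f +_) (∑-trace (fcc-partition 𝓢) B f))

    regroup : (S ∩ (A ∩ ∁ B)) ∪ (B ∩ ⋃ 𝓢) ≡ S ∩ A
    regroup = ⊆-antisym ⊆S∩A S∩A⊆
      where
      ⊆S∩A : (S ∩ (A ∩ ∁ B)) ∪ (B ∩ ⋃ 𝓢) ⊆ S ∩ A
      ⊆S∩A x∈ with x∈p∪q⁻ (S ∩ (A ∩ ∁ B)) _ x∈
      ... | inj₁ x∈′ = x∈p∩q⁺ (p∩q⊆p S _ x∈′ , p∩q⊆p A (∁ B) (p∩q⊆q S _ x∈′))
      ... | inj₂ x∈′ with ∈-⋃⁻ (p∩q⊆q B _ x∈′)
      ...   | T , T∈ , x∈T with ∨-true⁻ {𝓟 T} T∈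
      ...     | inj₁ T∈𝓟  = x∈p∩q⁺ (part⊆ pP T∈𝓟 x∈T , part⊆ pA B∈ (p∩q⊆p B _ x∈′))
      ...     | inj₂ T∈𝓐′ = ⊥-elim (∉B (part⊆ (partition-∖ᶠ pA B∈) T∈𝓐′ x∈T) (p∩q⊆p B _ x∈′))
      S∩A⊆ : S ∩ A ⊆ (S ∩ (A ∩ ∁ B)) ∪ (B ∩ ⋃ 𝓢)
      S∩A⊆ {x} x∈ with x ∈? B
      ... | no  x∉B = x∈p∪q⁺ (inj₁ (x∈p∩q⁺ (p∩q⊆p S A x∈ , x∈p∩q⁺ (p∩q⊆q S A x∈ , x∉p⇒x∈∁p x∉B))))
      ... | yes x∈B = let (P , P∈ , x∈P) = part-containing pP (p∩q⊆p S A x∈) in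
                      x∈p∪q⁺ (inj₂ (x∈p∩q⁺ (x∈B , ∈-⋃⁺ (P , ∨-trueˡ (𝓐′ P) P∈ , x∈P))))

    partition : IsPartition 𝓠 (S ∩ A)
    partition = subst (IsPartition 𝓠) regroup
                      (partition-∪ᶠ pQ′ (trace-partition (fcc-partition 𝓢) B) apart)

    rank-bound : ∑ (fcc (𝓟 ∪ᶠ 𝓐)) r + ∑ 𝓠 r ≤ ∑ 𝓟 r + ∑ 𝓐 r
    rank-bound rewrite ∑-fcc-adjoined r | ∑-𝓠 r | ∑-∖ᶠ 𝓐 {f = r} B∈ =
      rearrange-≤ (∑ (avoiding (fcc 𝓢) B) r) (∑ 𝓜 r) (∑ 𝓠′ r) (r (hull 𝓢 B)) (∑ 𝓜 (r ∘ (B ∩_)))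
                  (∑ 𝓟 r) (r B) (∑ 𝓐′ r)
                  (subst (λ j → j + ∑ 𝓠′ r ≤ ∑ 𝓟 r + ∑ 𝓐′ r) (∑-fcc r) rank-bound′)
                  (submodular-⋃ r submodular 𝓜 𝓜-pairwise B)
      where
      𝓜-pairwise : PairwiseDisjoint 𝓜
      𝓜-pairwise C∈ D∈ = parts-disjoint (fcc-partition 𝓢) (proj₁ (∈-meeting⁻ (fcc 𝓢) B C∈))
                                                           (proj₁ (∈-meeting⁻ (fcc 𝓢) B D∈))

    count : # 𝓟 + # 𝓐 ≡ # (fcc (𝓟 ∪ᶠ 𝓐)) + # 𝓠
    count rewrite #≡∑1 𝓟 | #≡∑1 𝓐 | #≡∑1 (fcc (𝓟 ∪ᶠ 𝓐)) | #≡∑1 𝓠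
                | ∑-𝓠 (λ _ → 1) | ∑-fcc-adjoined (λ _ → 1) | ∑-∖ᶠ 𝓐 {f = λ _ → 1} B∈ =
      rearrange-≡ (∑ 𝓟 (λ _ → 1)) (∑ 𝓐′ (λ _ → 1)) (∑ (avoiding (fcc 𝓢) B) (λ _ → 1))
                  (∑ 𝓜 (λ _ → 1)) (∑ 𝓠′ (λ _ → 1))
                  (trans (sym (cong₂ _+_ (#≡∑1 𝓟) (#≡∑1 𝓐′)))
                         (trans count′ (cong₂ _+_ (trans (#≡∑1 (fcc 𝓢)) (∑-fcc (λ _ → 1))) (#≡∑1 𝓠′))))

    coarsens-meet : ∀ {P A″} → P ∈F 𝓟 → A″ ∈F 𝓐 → Nonempty (P ∩ A″) → ∃ λ Q → Q ∈F 𝓠 × P ∩ A″ ⊆ Q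
    coarsens-meet {P} {A″} P∈ A″∈ ne with A″ ≟ˢ B
    ... | no A″≢B = let (Q , Q∈ , ⊆Q) = coarsens-meet′ P∈ (∈-∖ᶠ⁺ 𝓐 B A″∈ A″≢B) ne in Q , ∨-trueˡ _ Q∈ , ⊆Q
    ... | yes refl with block-containing-member 𝓢 (∨-trueˡ (𝓐′ P) P∈) (IsPartition.nonempty pP P P∈)
    ...   | C , b , P⊆C = B ∩ C , ∨-trueʳ (𝓠′ (B ∩ C)) (∈-trace⁺ (fcc 𝓢) B (fcc⁺ 𝓢 b) C∩B) , P∩B⊆B∩C
      where
      C∩B : Nonempty (C ∩ B)
      C∩B = let (x , x∈) = ne in x , x∈p∩q⁺ (P⊆C (p∩q⊆p P B x∈) , p∩q⊆q P B x∈)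
      P∩B⊆B∩C : P ∩ B ⊆ B ∩ C
      P∩B⊆B∩C x∈ = x∈p∩q⁺ (p∩q⊆q P B x∈ , P⊆C (p∩q⊆p P B x∈))

    witness : MeetWitness 𝓐 A
    witness = record
      { 𝓠 = 𝓠 ; partition = partition ; rank-bound = rank-bound ; coarsens-meet = coarsens-meet ; count = count }

  meet-witness : ∀ 𝓐 {A} → IsPartition 𝓐 A → MeetWitness 𝓐 A
  meet-witness = family-ind (λ 𝓐 → ∀ {A} → IsPartition 𝓐 A → MeetWitness 𝓐 A) meet-witness-∅ᶠ
    λ B∈ ih pA → AdjoinPart.witness B∈ pA (ih (partition-∖ᶠ pA B∈))

private
  pos-minus-interchange : ∀ x y u v → (ℤ.+ x ℤ.- ℤ.+ u) +ℤ (ℤ.+ y ℤ.- ℤ.+ v) ≡ ℤ.+ (x + y) ℤ.- ℤ.+ (u + v)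
  pos-minus-interchange x y u v rewrite ℤ.pos-+ x y | ℤ.pos-+ u v = interchange (ℤ.+ x) (ℤ.+ y) (ℤ.+ u) (ℤ.+ v)
    where
    interchange : ∀ X Y U V → (X ℤ.- U) +ℤ (Y ℤ.- V) ≡ (X +ℤ Y) ℤ.- (U +ℤ V)
    interchange = ℤ.solve-∀

module _ {n : ℕ} (M : Matroid n) where

  open Matroid M using (r)

  r̃-∑ : ∀ 𝓕 → r̃ M 𝓕 ≡ ℤ.+ (2 ℕ.* ∑ 𝓕 r) ℤ.- ℤ.+ (# 𝓕)
  r̃-∑ 𝓕 = trans (go (allSubsets n)) (cong (λ c → ℤ.+ (2 ℕ.* ∑ 𝓕 r) ℤ.- ℤ.+ c) (sym (#≡∑1 𝓕)))
    where
    go : ∀ L → foldr (λ T acc → if 𝓕 T then (ℤ.+ (2 ℕ.* r T) ℤ.- ℤ.+ 1) +ℤ acc else acc) (ℤ.+ 0) L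
             ≡ ℤ.+ (2 ℕ.* ∑ₗ L 𝓕 r) ℤ.- ℤ.+ (∑ₗ L 𝓕 (λ _ → 1))
    go []      = refl
    go (T ∷ L) with 𝓕 T
    ... | false = go L
    ... | true  = trans (cong ((ℤ.+ (2 ℕ.* r T) ℤ.- ℤ.+ 1) +ℤ_) (go L))
                        (trans (pos-minus-interchange (2 ℕ.* r T) _ 1 _)
                               (cong (λ s → ℤ.+ s ℤ.- ℤ.+ (1 + ∑ₗ L 𝓕 (λ _ → 1))) (sym (ℕ.*-distribˡ-+ 2 (r T) _))))

  r̃-pair : ∀ 𝓐 𝓑 → r̃ M 𝓐 +ℤ r̃ M 𝓑 ≡ ℤ.+ (2 ℕ.* (∑ 𝓐 r + ∑ 𝓑 r)) ℤ.- ℤ.+ (# 𝓐 + # 𝓑)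
  r̃-pair 𝓐 𝓑 = begin
    r̃ M 𝓐 +ℤ r̃ M 𝓑
      ≡⟨ cong₂ _+ℤ_ (r̃-∑ 𝓐) (r̃-∑ 𝓑) ⟩
    (ℤ.+ (2 ℕ.* ∑ 𝓐 r) ℤ.- ℤ.+ (# 𝓐)) +ℤ (ℤ.+ (2 ℕ.* ∑ 𝓑 r) ℤ.- ℤ.+ (# 𝓑))
      ≡⟨ pos-minus-interchange (2 ℕ.* ∑ 𝓐 r) (2 ℕ.* ∑ 𝓑 r) (# 𝓐) (# 𝓑) ⟩
    ℤ.+ (2 ℕ.* ∑ 𝓐 r + 2 ℕ.* ∑ 𝓑 r) ℤ.- ℤ.+ (# 𝓐 + # 𝓑)
      ≡⟨ cong (λ s → ℤ.+ s ℤ.- ℤ.+ (# 𝓐 + # 𝓑)) (sym (ℕ.*-distribˡ-+ 2 (∑ 𝓐 r) (∑ 𝓑 r))) ⟩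
    ℤ.+ (2 ℕ.* (∑ 𝓐 r + ∑ 𝓑 r)) ℤ.- ℤ.+ (# 𝓐 + # 𝓑) ∎
    where open ≡-Reasoning

  r̃-pair-≤ : ∀ {𝓐 𝓑 𝓒 𝓓} → ∑ 𝓒 r + ∑ 𝓓 r ≤ ∑ 𝓐 r + ∑ 𝓑 r → # 𝓐 + # 𝓑 ≡ # 𝓒 + # 𝓓 →
    r̃ M 𝓒 +ℤ r̃ M 𝓓 ℤ.≤ r̃ M 𝓐 +ℤ r̃ M 𝓑
  r̃-pair-≤ {𝓐} {𝓑} {𝓒} {𝓓} ∑≤ #≡ = begin
    r̃ M 𝓒 +ℤ r̃ M 𝓓
      ≡⟨ r̃-pair 𝓒 𝓓 ⟩
    ℤ.+ (2 ℕ.* (∑ 𝓒 r + ∑ 𝓓 r)) ℤ.- ℤ.+ (# 𝓒 + # 𝓓)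
      ≤⟨ ℤ.+-monoˡ-≤ (ℤ.- ℤ.+ (# 𝓒 + # 𝓓)) (ℤ.+≤+ (ℕ.*-monoʳ-≤ 2 ∑≤)) ⟩
    ℤ.+ (2 ℕ.* (∑ 𝓐 r + ∑ 𝓑 r)) ℤ.- ℤ.+ (# 𝓒 + # 𝓓)
      ≡⟨ cong (λ c → ℤ.+ (2 ℕ.* (∑ 𝓐 r + ∑ 𝓑 r)) ℤ.- ℤ.+ c) (sym #≡) ⟩
    ℤ.+ (2 ℕ.* (∑ 𝓐 r + ∑ 𝓑 r)) ℤ.- ℤ.+ (# 𝓐 + # 𝓑)
      ≡⟨ sym (r̃-pair 𝓐 𝓑) ⟩
    r̃ M 𝓐 +ℤ r̃ M 𝓑 ∎
    where open ℤ.≤-Reasoning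

∈-∧ᴾ⁻ : ∀ {n} (𝓟 𝓟′ : Family n) {R} → R ∈F (𝓟 ∧ᴾ 𝓟′) →
  ∃₂ λ P P′ → P ∈F 𝓟 × P′ ∈F 𝓟′ × P ∩ P′ ≡ R × Nonempty R
∈-∧ᴾ⁻ {n} 𝓟 𝓟′ R∈ with ∧-true⁻ R∈
... | ne , pair with any-true⁻ _ (allSubsets n) pair
...   | P , pair′ with ∧-true⁻ pair′
...     | P∈ , P′∃ with any-true⁻ _ (allSubsets n) P′∃
...       | P′ , P′∈∧eq with ∧-true⁻ P′∈∧eq
...         | P′∈ , eq = P , P′ , P∈ , P′∈ , =ˢ⁻ eq , nonemptyᵇ⁻ ne

lemma3p1 : ∀ {n} (M : Matroid n) → Loopless M →
    ∀ (S S' : Subset n) (𝓟 𝓟' : Family n) → IsPartition 𝓟 S → IsPartition 𝓟' S' →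
    ∃ λ (𝓠 : Family n) →
    IsPartition 𝓠 (S ∩ S')
    × (r̃ M 𝓟 +ℤ r̃ M 𝓟' ≥ r̃ M (𝓟 ∨ᴾ 𝓟') +ℤ r̃ M 𝓠)
    × IsCoarsening 𝓠 (𝓟 ∧ᴾ 𝓟')
    × (# 𝓟 + # 𝓟' ≡ # (𝓟 ∨ᴾ 𝓟') + # 𝓠)
lemma3p1 M _ S S' 𝓟 𝓟' pP pP' = 𝓠 , partition , r̃-pair-≤ M rank-bound count , coarsening , count
  where
  open MeetWitness (meet-witness (Matroid.r M) (Matroid.r-submod M) pP 𝓟' pP')

  coarsening : IsCoarsening 𝓠 (𝓟 ∧ᴾ 𝓟')
  coarsening R R∈ with ∈-∧ᴾ⁻ 𝓟 𝓟' R∈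
  ... | P , P' , P∈ , P'∈ , refl , ne = coarsens-meet P∈ P'∈ ne
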